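{- Let $n\ge 2$ and let $G=\langle r_0,\ldots,r_{n-1}\rangle\subset GL_n(\mathbb{Z})$ be a crystallographic linear Coxeter group with string diagram, given by a basic system $b_0,\ldots,b_{n-1}$ and Cartan integers $m_{ij}$ as described in the context, so that $G\simeq[p_1,\ldots,p_{n-1}]$. Let $s\ge 2$ and let $G^s=\langle r_0,\ldots,r_{n-1}\rangle^s\subseteq GL_n(\mathbb{Z}_s)$ be the reduction of $G$ modulo $s$ (we use the same names for the reduced generators). Then: (a) Each $r_i\in G^s$ has period $2$, except that $r_i=e$ when $s=2$ and node $i$ is e-e. (b) $r_i$ and $r_j$ commute in $G^s$ whenever $i<j-1$. (c) Suppose $p_i\in\{2,3,4,6\}$. If $s>2$, then $r_{i-1}r_i$ has period $p_i$ in $G^s$. If $s=2$: when $p_i=3$ or $6$, the period of $r_{i-1}r_i$ is $3$; when $p_i=4$, the period of $r_{i-1}r_i$ is $2$ if and only if at least one of the nodes $i-1$, $i$ is e-e (and otherwise it is $4$); when $p_i=2$, the period of $r_{i-1}r_i$ is $1$ if and only if both nodes $i-1$ and $i$ are e-e (in which case $r_{i-1}=r_i=e$). (d) Suppose $p_i=\infty$. Then $r_{i-1}r_i$ has period $s$ in $G^s$, except in the following cases, each occurring only when $s$ is even: if $m_{i-1,i}=m_{i,i-1}=2$ and both nodes $i-1$ and $i$ are e-e, the period is $s/2$; if $\{m_{i-1,i},m_{i,i-1}\}=\{4,1\}$ and the node $k\in\{i-1,i\}$ with $m_{k,k'}=4$ (where $k'$ is the other of the two nodes) is o-e, the period is 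$2s$.
   Context: Setup: $V=\mathbb{R}^n$ with basis $b_0,\ldots,b_{n-1}$. Integers $m_{ij}$ ($0\le i,j\le n-1$) satisfy $m_{ii}=-2$, $m_{ij}=0$ for $|i-j|\ge2$, and for $1\le i\le n-1$ the pair $(m_{i-1,i},m_{i,i-1})$ lies in $\{(0,0),(1,1),(1,2),(2,1),(1,3),(3,1),(1,4),(4,1),(2,2)\}$. The linear maps $r_i$ defined by $r_i(b_j)=b_j+m_{ij}b_i$ are reflections, and $G=\langle r_0,\ldots,r_{n-1}\rangle$ is the Coxeter group $[p_1,\ldots,p_{n-1}]$ with $p_i=2,3,4,6$ according as $m_{i-1,i}m_{i,i-1}=0,1,2,3$, and $p_i=\infty$ when $m_{i-1,i}m_{i,i-1}=4$. Reduction modulo $s$ means applying $\mathbb{Z}\to\mathbb{Z}_s$ to the integer matrices of the $r_i$ in the basis $(b_j)$; $e$ denotes the identity. Node types: with the convention $m_{0,-1}=m_{n-1,n}=0$, node $i$ is called e-e if both $m_{i,i-1}$ and $m_{i,i+1}$ are even, o-e if exactly one of them is even, and o-o if both are odd. -}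

module Defs where

open import Data.Nat as ℕ using (ℕ; zero; suc; _≤_; _<_; ∣_-_∣)
open import Data.Nat.Divisibility using (_∣_)
open import Data.Integer as ℤ using (ℤ; +_; -[1+_]; ∣_∣)
open import Data.Fin using (Fin; zero; suc; toℕ; inject₁; fromℕ<)
open import Data.Fin.Properties using (_≟_)
open import Data.Nat.Properties using (_<?_)
open import Data.Product using (_×_)
open import Data.Sum using (_⊎_)
open import Relation.Nullary using (¬_; yes; no)
open import Relation.Binary.PropositionalEquality using (_≡_)

Mat : ℕ → Set
Mat n = Fin n → Fin n → ℤ

∑ : ∀ {n} → (Fin n → ℤ) → ℤ
∑ {zero}  f = + 0
∑ {suc n} f = f zero ℤ.+ ∑ (λ k → f (suc k))

_⊗_ : ∀ {n} → Mat n → Mat n → Mat n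
(A ⊗ B) i j = ∑ (λ k → A i k ℤ.* B k j)

I : ∀ {n} → Mat n
I i j with i ≟ j
... | yes _ = + 1
... | no  _ = + 0

_^_ : ∀ {n} → Mat n → ℕ → Mat n
A ^ zero  = I
A ^ suc k = A ⊗ (A ^ k)

-- Reduction modulo s: two integer matrices define the same element of
-- GL_n(ℤ_s) iff all entries are congruent modulo s.

_≡ℤ[_]_ : ℤ → ℕ → ℤ → Set
a ≡ℤ[ s ] b = s ∣ ∣ a ℤ.- b ∣

_≈[_]_ : ∀ {n} → Mat n → ℕ → Mat n → Set
A ≈[ s ] B = ∀ i j → A i j ≡ℤ[ s ] B i j

HasPeriod : ∀ {n} → ℕ → Mat n → ℕ → Set
HasPeriod s A k =
  1 ≤ k × (A ^ k) ≈[ s ] I × (∀ j → 1 ≤ j → j < k → ¬ ((A ^ j) ≈[ s ] I))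

data AllowedPair : ℤ → ℤ → Set where
  p00 : AllowedPair (+ 0) (+ 0)
  p11 : AllowedPair (+ 1) (+ 1)
  p12 : AllowedPair (+ 1) (+ 2)
  p21 : AllowedPair (+ 2) (+ 1)
  p13 : AllowedPair (+ 1) (+ 3)
  p31 : AllowedPair (+ 3) (+ 1)
  p14 : AllowedPair (+ 1) (+ 4)
  p41 : AllowedPair (+ 4) (+ 1)
  p22 : AllowedPair (+ 2) (+ 2)

Pred : ∀ {n} → Fin n → Fin n → Set
Pred j i = suc (toℕ j) ≡ toℕ i

record Cartan (n : ℕ) : Set where
  field
    m        : Fin n → Fin n → ℤ
    diag     : ∀ i → m i i ≡ -[1+ 1 ]
    far      : ∀ i j → 2 ≤ ∣ toℕ i - toℕ j ∣ → m i j ≡ + 0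
    adjacent : ∀ j i → Pred j i → AllowedPair (m j i) (m i j)
open Cartan public

-- the generator r_i: r_i(b_j) = b_j + m_ij b_i, i.e. column j of the
-- matrix is e_j + m_ij e_i
refl-mat : ∀ {n} → Cartan n → Fin n → Mat n
refl-mat C i k j with k ≟ i
... | yes _ = I k j ℤ.+ m C i j
... | no  _ = I k j

data Label : Set where
  fin : ℕ → Label
  ∞   : Label

labelOf : ℕ → Label
labelOf 0 = fin 2
labelOf 1 = fin 3
labelOf 2 = fin 4
labelOf 3 = fin 6
labelOf _ = ∞

p : ∀ {n} → Cartan n → Fin n → Fin n → Label
p C j i = labelOf ∣ m C j i ℤ.* m C i j ∣

-- Node types, with the convention m_{0,-1} = m_{n-1,n} = 0

mL : ∀ {n} → Cartan n → Fin n → ℤ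
mL C zero    = + 0
mL C (suc k) = m C (suc k) (inject₁ k)

mR : ∀ {n} → Cartan n → Fin n → ℤ
mR {n} C i with suc (toℕ i) <? n
... | yes lt = m C i (fromℕ< lt)
... | no  _  = + 0

EvenZ : ℤ → Set
EvenZ x = 2 ∣ ∣ x ∣

OddZ : ℤ → Set
OddZ x = ¬ EvenZ x

EE : ∀ {n} → Cartan n → Fin n → Set
EE C i = EvenZ (mL C i) × EvenZ (mR C i)

OE : ∀ {n} → Cartan n → Fin n → Set
OE C i = (EvenZ (mL C i) × OddZ (mR C i)) ⊎ (OddZ (mL C i) × EvenZ (mR C i))

OO : ∀ {n} → Cartan n → Fin n → Set
OO C i = OddZ (mL C i) × OddZ (mR C i)

-- Every matrix in the argument is a rank-two perturbation I + e_j uᵀ + e_i vᵀ of the identity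
-- (`Rank2`), and these multiply by an explicit rule (`Rank2-⊗`).  A generator is r_i = I + e_i m_iᵀ
-- with m_i the i-th Cartan row; this gives r_i² = I and part (b) directly, and part (a) because
-- r_i ≡ I (mod s) means that s divides the row m_i, which contains m_ii = -2.  For an edge
-- j = i-1 → i the powers of A = r_j r_i are  I + e_j (P_k m_j + Q_k m_i)ᵀ + e_i (R_k m_j + T_k m_i)ᵀ
-- with integer coefficients obeying a recurrence in a = m_ji and b = m_ij (`pair-power`).  In a
-- string diagram a column (m_jc, m_ic) takes one of five values built from a, b and the outer
-- neighbours x = m_{j,j-1}, y = m_{i,i+1} (`column-shape`), so A^k ≡ I (mod s) becomes an arithmetic
-- condition on (s, a, b, x, y, k) and the period of A its least solution (`period-transfer`).
-- That arithmetic is settled for each of the nine allowed pairs (a, b): finite labels by evaluating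
-- the periodic coefficients, the affine pairs (1,4), (4,1), (2,2) through closed forms in k and
-- k(k-1)/2.  The theorem at the end assembles the four parts.

module Submission where

open import Defs

module Development where
  open import Data.Nat as ℕ using (ℕ; zero; suc; z≤n; s≤s)
  import Data.Nat.Divisibility as ℕ∣
  import Data.Nat.Properties as ℕₚ
  open import Data.Integer as ℤ using (ℤ; +_; -[1+_]; -_; _+_; _*_; _-_)
  import Data.Integer.Properties as ℤₚ
  open import Data.Integer.Tactic.RingSolver using (solve-∀)
  open import Data.Integer.Divisibility.Signed as ℤ∣ using (divides)
  open import Data.Fin using (Fin; zero; suc; toℕ; inject₁; fromℕ<)
  open import Data.Fin.Properties using (_≟_; suc-injective; toℕ-injective; toℕ-inject₁; toℕ-fromℕ<; toℕ<n)
  open import Data.Product using (_×_; _,_; Σ; proj₁; proj₂)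
  open import Data.Sum using (_⊎_; inj₁; inj₂)
  open import Relation.Nullary using (¬_; yes; no; Dec)
  open import Relation.Binary.PropositionalEquality
  open ≡-Reasoning
  open import Data.Empty using (⊥-elim)
  open import Function using (_∘′_)
  open import Data.Nat.DivMod using (m*n/n≡m)

  _≐_ : ∀ {n} → Mat n → Mat n → Set
  A ≐ B = ∀ l c → A l c ≡ B l c

  ∑-cong : ∀ {n} {f g : Fin n → ℤ} → (∀ k → f k ≡ g k) → ∑ f ≡ ∑ g
  ∑-cong {zero}  e = refl
  ∑-cong {suc n} e = cong₂ _+_ (e zero) (∑-cong (λ k → e (suc k)))

  ∑-+ : ∀ {n} (f g : Fin n → ℤ) → ∑ (λ k → f k + g k) ≡ ∑ f + ∑ g
  ∑-+ {zero}  f g = refl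
  ∑-+ {suc n} f g =
    trans (cong (_+_ (f zero + g zero)) (∑-+ (λ k → f (suc k)) (λ k → g (suc k))))
          (interchange (f zero) (g zero) _ _)
    where
    interchange : ∀ a b c d → (a + b) + (c + d) ≡ (a + c) + (b + d)
    interchange = solve-∀

  ∑-*ʳ : ∀ {n} (f : Fin n → ℤ) c → ∑ (λ k → f k * c) ≡ ∑ f * c
  ∑-*ʳ {zero}  f c = refl
  ∑-*ʳ {suc n} f c = trans (cong (_+_ (f zero * c)) (∑-*ʳ (λ k → f (suc k)) c))
                           (sym (ℤₚ.*-distribʳ-+ c (f zero) _))

  ∑-zero : ∀ {n} (f : Fin n → ℤ) → (∀ k → f k ≡ + 0) → ∑ f ≡ + 0
  ∑-zero {zero}  f e = refl
  ∑-zero {suc n} f e = cong₂ _+_ (e zero) (∑-zero (λ k → f (suc k)) (λ k → e (suc k)))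

  I-diag : ∀ {n} (a : Fin n) → I a a ≡ + 1
  I-diag a with a ≟ a
  ... | yes _ = refl
  ... | no a≢a = ⊥-elim (a≢a refl)

  I-off : ∀ {n} {a b : Fin n} → ¬ a ≡ b → I a b ≡ + 0
  I-off {a = a} {b} a≢b with a ≟ b
  ... | yes a≡b = ⊥-elim (a≢b a≡b)
  ... | no _ = refl

  I-suc : ∀ {n} (a b : Fin n) → I (suc a) (suc b) ≡ I a b
  I-suc a b = by-cases (a ≟ b)
    where
    by-cases : Dec (a ≡ b) → I (suc a) (suc b) ≡ I a b
    by-cases (yes refl) = trans (I-diag (suc a)) (sym (I-diag a))
    by-cases (no a≢b) = trans (I-off (λ e → a≢b (suc-injective e))) (sym (I-off a≢b))

  I-sym : ∀ {n} (a b : Fin n) → I a b ≡ I b a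
  I-sym a b = by-cases (a ≟ b)
    where
    by-cases : Dec (a ≡ b) → I a b ≡ I b a
    by-cases (yes refl) = refl
    by-cases (no a≢b) = trans (I-off a≢b) (sym (I-off (λ e → a≢b (sym e))))

  ∑-δˡ : ∀ {n} (l : Fin n) (g : Fin n → ℤ) → ∑ (λ k → I l k * g k) ≡ g l
  ∑-δˡ {suc n} zero g =
    trans (cong₂ _+_ (cong (_* g zero) (I-diag {suc n} zero))
                     (∑-zero _ (λ k → cong (_* g (suc k)) (I-off {a = zero} {suc k} (λ ())))))
          (trans (ℤₚ.+-identityʳ _) (ℤₚ.*-identityˡ _))
  ∑-δˡ {suc n} (suc l) g =
    trans (cong₂ _+_ (cong (_* g zero) (I-off {a = suc l} {zero} (λ ())))
                     (trans (∑-cong (λ k → cong (_* g (suc k)) (I-suc l k)))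
                            (∑-δˡ l (λ k → g (suc k)))))
          (ℤₚ.+-identityˡ (g (suc l)))

  ∑-δʳ : ∀ {n} (c : Fin n) (g : Fin n → ℤ) → ∑ (λ k → g k * I k c) ≡ g c
  ∑-δʳ c g = trans (∑-cong (λ k → trans (ℤₚ.*-comm (g k) (I k c)) (cong (_* g k) (I-sym k c))))
                   (∑-δˡ c g)

  Rank2 : ∀ {n} → Fin n → Fin n → (Fin n → ℤ) → (Fin n → ℤ) → Mat n
  Rank2 j i u v l c = I l c + I l j * u c + I l i * v c

  0⃗ : ∀ {n} → Fin n → ℤ
  0⃗ _ = + 0

  Rank2-cong : ∀ {n} (j i : Fin n) {u u′ v v′ : Fin n → ℤ} →
    (∀ c → u c ≡ u′ c) → (∀ c → v c ≡ v′ c) → Rank2 j i u v ≐ Rank2 j i u′ v′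
  Rank2-cong j i u≡ v≡ l c = cong₂ (λ x y → I l c + I l j * x + I l i * y) (u≡ c) (v≡ c)

  ⊗-cong : ∀ {n} {A A′ B B′ : Mat n} → A ≐ A′ → B ≐ B′ → (A ⊗ B) ≐ (A′ ⊗ B′)
  ⊗-cong A≐ B≐ l c = ∑-cong (λ k → cong₂ _*_ (A≐ l k) (B≐ k c))

  row⊗Rank2 : ∀ {n} (j i : Fin n) u v (g : Fin n → ℤ) c →
    ∑ (λ k → g k * Rank2 j i u v k c) ≡ g c + g j * u c + g i * v c
  row⊗Rank2 j i u v g c = begin
    ∑ (λ k → g k * Rank2 j i u v k c)
      ≡⟨ ∑-cong (λ k → expand (g k) (I k c) (I k j) (u c) (I k i) (v c)) ⟩
    ∑ (λ k → g k * I k c + ((g k * I k j) * u c + (g k * I k i) * v c))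
      ≡⟨ ∑-+ (λ k → g k * I k c) (λ k → (g k * I k j) * u c + (g k * I k i) * v c) ⟩
    ∑ (λ k → g k * I k c) + ∑ (λ k → (g k * I k j) * u c + (g k * I k i) * v c)
      ≡⟨ cong₂ _+_ (∑-δʳ c g) (∑-+ (λ k → (g k * I k j) * u c) (λ k → (g k * I k i) * v c)) ⟩
    g c + (∑ (λ k → (g k * I k j) * u c) + ∑ (λ k → (g k * I k i) * v c))
      ≡⟨ cong (_+_ (g c)) (cong₂ _+_ (trans (∑-*ʳ (λ k → g k * I k j) (u c)) (cong (_* u c) (∑-δʳ j g)))
                                    (trans (∑-*ʳ (λ k → g k * I k i) (v c)) (cong (_* v c) (∑-δʳ i g)))) ⟩
    g c + (g j * u c + g i * v c)
      ≡⟨ sym (ℤₚ.+-assoc (g c) _ _) ⟩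
    g c + g j * u c + g i * v c ∎
    where
    expand : ∀ x a b u d v → x * (a + b * u + d * v) ≡ x * a + ((x * b) * u + (x * d) * v)
    expand = solve-∀

  Rank2-⊗ : ∀ {n} (j i : Fin n) α β u v →
    (Rank2 j i α β ⊗ Rank2 j i u v) ≐
    Rank2 j i (λ c → α c + u c + α j * u c + α i * v c) (λ c → β c + v c + β j * u c + β i * v c)
  Rank2-⊗ j i α β u v l c =
    trans (row⊗Rank2 j i u v (Rank2 j i α β l) c)
          (collect (I l c) (I l j) (I l i) (α c) (β c) (α j) (β j) (α i) (β i) (u c) (v c))
    where
    collect : ∀ Ilc Ilj Ili αc βc αj βj αi βi uc vc →
      (Ilc + Ilj * αc + Ili * βc) + (Ilj + Ilj * αj + Ili * βj) * uc
        + (Ili + Ilj * αi + Ili * βi) * vc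
      ≡ Ilc + Ilj * (αc + uc + αj * uc + αi * vc) + Ili * (βc + vc + βj * uc + βi * vc)
    collect = solve-∀

  refl-entry : ∀ {n} (C : Cartan n) i l c → refl-mat C i l c ≡ I l c + I l i * m C i c
  refl-entry C i l c with l ≟ i
  ... | yes _ = cong (_+_ (I l c)) (sym (ℤₚ.*-identityˡ _))
  ... | no _  = sym (trans (cong (_+_ (I l c)) (ℤₚ.*-zeroˡ (m C i c))) (ℤₚ.+-identityʳ _))

  refl-as-first : ∀ {n} (C : Cartan n) i k → refl-mat C i ≐ Rank2 i k (m C i) 0⃗
  refl-as-first C i k l c = trans (refl-entry C i l c) (pad (I l c) (I l i) (m C i c) (I l k))
    where
    pad : ∀ a b x d → a + b * x ≡ a + b * x + d * + 0
    pad = solve-∀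

  refl-as-second : ∀ {n} (C : Cartan n) k i → refl-mat C i ≐ Rank2 k i 0⃗ (m C i)
  refl-as-second C k i l c = trans (refl-entry C i l c) (pad (I l c) (I l k) (I l i) (m C i c))
    where
    pad : ∀ a d b x → a + b * x ≡ a + d * + 0 + b * x
    pad = solve-∀

  infix 4 _∣ᶻ_
  _∣ᶻ_ : ℕ → ℤ → Set
  s ∣ᶻ z = + s ℤ∣.∣ z

  ∣ᶻ0 : ∀ s → s ∣ᶻ + 0
  ∣ᶻ0 s = divides (+ 0) refl

  ≈I-resp : ∀ {n s} {A B : Mat n} → A ≐ B → A ≈[ s ] I → B ≈[ s ] I
  ≈I-resp {s = s} A≐B A≈I l c = subst (λ z → s ℕ∣.∣ ℤ.∣ z - I l c ∣) (A≐B l c) (A≈I l c)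

  Rank2-minus-I : ∀ {n} (j i : Fin n) u v l c → Rank2 j i u v l c - I l c ≡ I l j * u c + I l i * v c
  Rank2-minus-I j i u v l c = cancel (I l c) (I l j * u c) (I l i * v c)
    where
    cancel : ∀ a x y → a + x + y - a ≡ x + y
    cancel = solve-∀

  Rank2≈I : ∀ {n s} (j i : Fin n) u v → (∀ c → s ∣ᶻ u c × s ∣ᶻ v c) → Rank2 j i u v ≈[ s ] I
  Rank2≈I {s = s} j i u v s∣uv l c with s∣uv c
  ... | s∣u , s∣v = ℤ∣.∣⇒∣ᵤ (subst (s ∣ᶻ_) (sym (Rank2-minus-I j i u v l c))
                      (ℤ∣.∣m∣n⇒∣m+n (ℤ∣.∣n⇒∣m*n (I l j) s∣u) (ℤ∣.∣n⇒∣m*n (I l i) s∣v)))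

  -- ... and, when j ≢ i, only then: rows j and i of the difference are u and v.
  Rank2≈I⇒ : ∀ {n s} (j i : Fin n) u v → ¬ j ≡ i → Rank2 j i u v ≈[ s ] I → ∀ c → s ∣ᶻ u c × s ∣ᶻ v c
  Rank2≈I⇒ {s = s} j i u v j≢i ≈I c =
    subst (s ∣ᶻ_) (row j (I-diag j) (I-off j≢i) (pick-first (u c) (v c))) (ℤ∣.∣ᵤ⇒∣ (≈I j c)) ,
    subst (s ∣ᶻ_) (row i (I-off (λ e → j≢i (sym e))) (I-diag i) (pick-second (u c) (v c))) (ℤ∣.∣ᵤ⇒∣ (≈I i c))
    where
    row : ∀ l {x y z} → I l j ≡ x → I l i ≡ y → x * u c + y * v c ≡ z → Rank2 j i u v l c - I l c ≡ z
    row l refl refl e = trans (Rank2-minus-I j i u v l c) e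
    pick-first : ∀ x y → + 1 * x + + 0 * y ≡ x
    pick-first = solve-∀
    pick-second : ∀ x y → + 0 * x + + 1 * y ≡ y
    pick-second = solve-∀

  -- Coefficients (P, Q, R, T) expressing a power of a product of two reflections
  -- through the two rows f = m_j and g = m_i:  I + e_j (P f + Q g)ᵀ + e_i (R f + T g)ᵀ.
  record Coeffs : Set where
    constructor coeffs
    field P Q R T : ℤ
  open Coeffs

  -- The effect of one more factor A = I + e_j (f + a g)ᵀ + e_i gᵀ, where a = f_i and b = g_j.
  next : ℤ → ℤ → Coeffs → Coeffs
  next a b q = coeffs (+ 1 + (a * b - + 1) * P q - a * R q) (a + (a * b - + 1) * Q q - a * T q)
                      (b * P q - R q) (+ 1 + b * Q q - T q)

  powCoeffs : ℤ → ℤ → ℕ → Coeffs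
  powCoeffs a b zero    = coeffs (+ 0) (+ 0) (+ 0) (+ 0)
  powCoeffs a b (suc k) = next a b (powCoeffs a b k)

  powRow₁ powRow₂ : ∀ {n} → ℤ → ℤ → (f g : Fin n → ℤ) → ℕ → Fin n → ℤ
  powRow₁ a b f g k c = P (powCoeffs a b k) * f c + Q (powCoeffs a b k) * g c
  powRow₂ a b f g k c = R (powCoeffs a b k) * f c + T (powCoeffs a b k) * g c

  power-formula : ∀ {n} (A : Mat n) (j i : Fin n) (f g : Fin n → ℤ) a b →
    f j ≡ - + 2 → f i ≡ a → g j ≡ b → g i ≡ - + 2 →
    A ≐ Rank2 j i (λ c → f c + a * g c) g →
    ∀ k → (A ^ k) ≐ Rank2 j i (powRow₁ a b f g k) (powRow₂ a b f g k)
  power-formula A j i f g a b fj fi gj gi A≐ zero l c =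
    vanish (I l c) (I l j) (I l i) (f c) (g c)
    where
    vanish : ∀ x y z u v → x ≡ x + y * (+ 0 * u + + 0 * v) + z * (+ 0 * u + + 0 * v)
    vanish = solve-∀
  power-formula A j i f g a b fj fi gj gi A≐ (suc k) l c = begin
    (A ⊗ (A ^ k)) l c
      ≡⟨ ⊗-cong A≐ (power-formula A j i f g a b fj fi gj gi A≐ k) l c ⟩
    (Rank2 j i (λ c → f c + a * g c) g ⊗ Rank2 j i (powRow₁ a b f g k) (powRow₂ a b f g k)) l c
      ≡⟨ Rank2-⊗ j i _ g (powRow₁ a b f g k) (powRow₂ a b f g k) l c ⟩
    _ ≡⟨ Rank2-cong j i step₁ step₂ l c ⟩
    Rank2 j i (powRow₁ a b f g (suc k)) (powRow₂ a b f g (suc k)) l c ∎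
    where
    q = powCoeffs a b k
    step₁ : ∀ c → (f c + a * g c) + powRow₁ a b f g k c + (f j + a * g j) * powRow₁ a b f g k c
                    + (f i + a * g i) * powRow₂ a b f g k c ≡ powRow₁ a b f g (suc k) c
    step₁ c = trans (cong₂ (λ x y → (f c + a * g c) + powRow₁ a b f g k c + x * powRow₁ a b f g k c
                                      + y * powRow₂ a b f g k c)
                           (cong₂ (λ u v → u + a * v) fj gj) (cong₂ (λ u v → u + a * v) fi gi))
                    (ring (f c) (g c) a b (P q) (Q q) (R q) (T q))
      where
      ring : ∀ x y a b P Q R T →
        (x + a * y) + (P * x + Q * y) + (- + 2 + a * b) * (P * x + Q * y) + (a + a * - + 2) * (R * x + T * y)
        ≡ (+ 1 + (a * b - + 1) * P - a * R) * x + (a + (a * b - + 1) * Q - a * T) * y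
      ring = solve-∀
    step₂ : ∀ c → g c + powRow₂ a b f g k c + g j * powRow₁ a b f g k c
                    + g i * powRow₂ a b f g k c ≡ powRow₂ a b f g (suc k) c
    step₂ c = trans (cong₂ (λ x y → g c + powRow₂ a b f g k c + x * powRow₁ a b f g k c
                                      + y * powRow₂ a b f g k c) gj gi)
                    (ring (f c) (g c) b (P q) (Q q) (R q) (T q))
      where
      ring : ∀ x y b P Q R T →
        y + (R * x + T * y) + b * (P * x + Q * y) + - + 2 * (R * x + T * y)
        ≡ (b * P - R) * x + (+ 1 + b * Q - T) * y
      ring = solve-∀

  refl-product : ∀ {n} (C : Cartan n) j i →
    (refl-mat C j ⊗ refl-mat C i) ≐ Rank2 j i (λ c → m C j c + m C j i * m C i c) (m C i)
  refl-product C j i l c = begin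
    (refl-mat C j ⊗ refl-mat C i) l c
      ≡⟨ ⊗-cong (refl-as-first C j i) (refl-as-second C j i) l c ⟩
    (Rank2 j i (m C j) 0⃗ ⊗ Rank2 j i 0⃗ (m C i)) l c
      ≡⟨ Rank2-⊗ j i (m C j) 0⃗ 0⃗ (m C i) l c ⟩
    _ ≡⟨ Rank2-cong j i (λ c → simplify₁ (m C j c) (m C i c) (m C j j) (m C j i))
                        (λ c → simplify₂ (m C i c)) l c ⟩
    Rank2 j i (λ c → m C j c + m C j i * m C i c) (m C i) l c ∎
    where
    simplify₁ : ∀ x y d a → x + + 0 + d * + 0 + a * y ≡ x + a * y
    simplify₁ = solve-∀
    simplify₂ : ∀ y → + 0 + y + + 0 * + 0 + + 0 * y ≡ y
    simplify₂ = solve-∀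

  pair-power : ∀ {n} (C : Cartan n) j i k →
    ((refl-mat C j ⊗ refl-mat C i) ^ k)
      ≐ Rank2 j i (powRow₁ (m C j i) (m C i j) (m C j) (m C i) k)
                  (powRow₂ (m C j i) (m C i j) (m C j) (m C i) k)
  pair-power C j i =
    power-formula _ j i (m C j) (m C i) (m C j i) (m C i j) (diag C j) refl refl (diag C i)
                  (refl-product C j i)

  apart : ∀ a b → suc (suc a) ℕ.≤ b → 2 ℕ.≤ ℕ.∣ a - b ∣
  apart zero    (suc (suc b)) _        = s≤s (s≤s z≤n)
  apart zero    (suc zero)    (s≤s ())
  apart (suc a) (suc b)       (s≤s le) = apart a b le

  far-right-zero : ∀ {n} (C : Cartan n) i c → suc (suc (toℕ i)) ℕ.≤ toℕ c → m C i c ≡ + 0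
  far-right-zero C i c le = far C i c (apart (toℕ i) (toℕ c) le)

  far-left-zero : ∀ {n} (C : Cartan n) i c → suc (suc (toℕ c)) ℕ.≤ toℕ i → m C i c ≡ + 0
  far-left-zero C i c le = far C i c (subst (2 ℕ.≤_) (ℕₚ.∣-∣-comm (toℕ c) (toℕ i)) (apart (toℕ c) (toℕ i) le))

  data Position (J C′ : ℕ) : Set where
    at-J      : C′ ≡ J → Position J C′
    at-J+1    : C′ ≡ suc J → Position J C′
    at-J-1    : suc C′ ≡ J → Position J C′
    at-J+2    : C′ ≡ suc (suc J) → Position J C′
    far-left  : suc (suc C′) ℕ.≤ J → Position J C′
    far-right : suc (suc (suc J)) ℕ.≤ C′ → Position J C′

  position : ∀ J C′ → Position J C′
  position zero          zero                  = at-J refl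
  position zero          (suc zero)            = at-J+1 refl
  position zero          (suc (suc zero))      = at-J+2 refl
  position zero          (suc (suc (suc C′)))  = far-right (s≤s (s≤s (s≤s z≤n)))
  position (suc zero)    zero                  = at-J-1 refl
  position (suc (suc J)) zero                  = far-left (s≤s (s≤s z≤n))
  position (suc J)       (suc C′) with position J C′
  ... | at-J e      = at-J (cong suc e)
  ... | at-J+1 e    = at-J+1 (cong suc e)
  ... | at-J-1 e    = at-J-1 (cong suc e)
  ... | at-J+2 e    = at-J+2 (cong suc e)
  ... | far-left le  = far-left (s≤s le)
  ... | far-right le = far-right (s≤s le)

  mL-entry : ∀ {n} (C : Cartan n) i → mL C i ≡ + 0 ⊎ Σ (Fin n) (λ c → suc (toℕ c) ≡ toℕ i × m C i c ≡ mL C i)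
  mL-entry C zero    = inj₁ refl
  mL-entry C (suc i) = inj₂ (inject₁ i , cong suc (toℕ-inject₁ i) , refl)

  mL-is : ∀ {n} (C : Cartan n) j i → Pred j i → mL C i ≡ m C i j
  mL-is C j zero    ()
  mL-is C j (suc i) j→i = cong (m C (suc i)) (toℕ-injective (trans (toℕ-inject₁ i) (sym (ℕₚ.suc-injective j→i))))

  mR-is : ∀ {n} (C : Cartan n) i c → toℕ c ≡ suc (toℕ i) → m C i c ≡ mR C i
  mR-is {n} C i c e with suc (toℕ i) ℕₚ.<? n
  ... | yes lt = cong (m C i) (toℕ-injective (trans e (sym (toℕ-fromℕ< lt))))
  ... | no ¬lt = ⊥-elim (¬lt (subst (ℕ._< n) e (toℕ<n c)))

  mR-entry : ∀ {n} (C : Cartan n) i → mR C i ≡ + 0 ⊎ Σ (Fin n) (λ c → toℕ c ≡ suc (toℕ i) × m C i c ≡ mR C i)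
  mR-entry {n} C i with suc (toℕ i) ℕₚ.<? n
  ... | yes lt = inj₂ (fromℕ< lt , toℕ-fromℕ< lt , refl)
  ... | no _   = inj₁ refl

  row-entry : ∀ {n} (C : Cartan n) i c →
    m C i c ≡ - + 2 ⊎ m C i c ≡ mL C i ⊎ m C i c ≡ mR C i ⊎ m C i c ≡ + 0
  row-entry C i c with position (toℕ i) (toℕ c)
  ... | at-J e with toℕ-injective e
  ...   | refl = inj₁ (diag C c)
  row-entry C i c | at-J+1 e = inj₂ (inj₂ (inj₁ (mR-is C i c e)))
  row-entry C zero c | at-J-1 ()
  row-entry C (suc i) c | at-J-1 e
    with toℕ-injective {i = c} {inject₁ i} (trans (ℕₚ.suc-injective e) (sym (toℕ-inject₁ i)))
  ... | refl = inj₂ (inj₁ refl)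
  row-entry C i c | at-J+2 e    = inj₂ (inj₂ (inj₂ (far-right-zero C i c (ℕₚ.≤-reflexive (sym e)))))
  row-entry C i c | far-left le  = inj₂ (inj₂ (inj₂ (far-left-zero C i c le)))
  row-entry C i c | far-right le = inj₂ (inj₂ (inj₂ (far-right-zero C i c (ℕₚ.<⇒≤ le))))

  data ColumnShape (a b x y : ℤ) : ℤ → ℤ → Set where
    column-j     : ColumnShape a b x y (- + 2) b
    column-i     : ColumnShape a b x y a (- + 2)
    column-left  : ColumnShape a b x y x (+ 0)
    column-right : ColumnShape a b x y (+ 0) y
    column-far   : ColumnShape a b x y (+ 0) (+ 0)

  PairShape : ∀ {n} → Cartan n → Fin n → Fin n → ℤ → ℤ → Set
  PairShape C j i = ColumnShape (m C j i) (m C i j) (mL C j) (mR C i)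

  column-shape : ∀ {n} (C : Cartan n) j i → Pred j i → ∀ c → PairShape C j i (m C j c) (m C i c)
  column-shape C j i j→i c with position (toℕ j) (toℕ c)
  ... | at-J e with toℕ-injective e
  ...   | refl = subst (λ z → PairShape C j i z (m C i c)) (sym (diag C c)) column-j
  column-shape C j i j→i c | at-J+1 e with toℕ-injective (trans e j→i)
  ... | refl = subst (PairShape C j i (m C j c)) (sym (diag C c)) column-i
  column-shape C zero i j→i c | at-J-1 ()
  column-shape C (suc j) i j→i c | at-J-1 e
    with toℕ-injective {i = c} {inject₁ j} (trans (ℕₚ.suc-injective e) (sym (toℕ-inject₁ j)))
  ... | refl = subst (PairShape C (suc j) i (mL C (suc j))) (sym i-zero) column-left
    where
    i-zero : m C i (inject₁ j) ≡ + 0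
    i-zero = far-left-zero C i (inject₁ j)
               (ℕₚ.≤-reflexive (trans (cong (λ z → suc (suc z)) (toℕ-inject₁ j)) j→i))
  column-shape C j i j→i c | at-J+2 e =
    subst₂ (PairShape C j i) (sym (far-right-zero C j c (ℕₚ.≤-reflexive (sym e))))
           (sym (mR-is C i c (trans e (cong suc j→i)))) column-right
  column-shape C j i j→i c | far-left le =
    subst₂ (PairShape C j i) (sym (far-left-zero C j c le))
           (sym (far-left-zero C i c (subst (suc (suc (toℕ c)) ℕ.≤_) j→i (ℕₚ.m≤n⇒m≤1+n le)))) column-far
  column-shape C j i j→i c | far-right le =
    subst₂ (PairShape C j i) (sym (far-right-zero C j c (ℕₚ.<⇒≤ le)))
           (sym (far-right-zero C i c (subst (λ z → suc (suc z) ℕ.≤ toℕ c) j→i le))) column-far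

  Killed : ℕ → Coeffs → ℤ → ℤ → Set
  Killed s q u v = s ∣ᶻ P q * u + Q q * v × s ∣ᶻ R q * u + T q * v

  killed-zero : ∀ s q → Killed s q (+ 0) (+ 0)
  killed-zero s q = subst (s ∣ᶻ_) (sym (vanish (P q) (Q q))) (∣ᶻ0 s) ,
                    subst (s ∣ᶻ_) (sym (vanish (R q) (T q))) (∣ᶻ0 s)
    where
    vanish : ∀ u v → u * + 0 + v * + 0 ≡ + 0
    vanish = solve-∀

  record Kills (s : ℕ) (a b x y : ℤ) (q : Coeffs) : Set where
    constructor kills
    field
      kills-j     : Killed s q (- + 2) b
      kills-i     : Killed s q a (- + 2)
      kills-left  : Killed s q x (+ 0)
      kills-right : Killed s q (+ 0) y
  open Kills

  Least : (ℕ → Set) → ℕ → Set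
  Least K q = 1 ℕ.≤ q × K q × (∀ k → 1 ℕ.≤ k → k ℕ.< q → ¬ K k)

  Least-transfer : ∀ {K K′ : ℕ → Set} {q} → (∀ k → K k → K′ k) → (∀ k → K′ k → K k) →
    Least K q → Least K′ q
  Least-transfer to from (1≤q , Kq , minimal) =
    1≤q , to _ Kq , λ k 1≤k k<q K′k → minimal k 1≤k k<q (from k K′k)

  ArithPeriod : ℕ → ℤ → ℤ → ℤ → ℤ → ℕ → Set
  ArithPeriod s a b x y = Least (λ k → Kills s a b x y (powCoeffs a b k))

  module _ {n} (C : Cartan n) (j i : Fin n) (j→i : Pred j i) (s : ℕ) where
    private
      a b x y : ℤ
      a = m C j i
      b = m C i j
      x = mL C j
      y = mR C i
      A : Mat n
      A = refl-mat C j ⊗ refl-mat C i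
      ColumnsKilled : Coeffs → Set
      ColumnsKilled q = ∀ c → Killed s q (m C j c) (m C i c)

    kills⇒columns : ∀ q → Kills s a b x y q → ColumnsKilled q
    kills⇒columns q K c = by-shape (column-shape C j i j→i c)
      where
      by-shape : ∀ {u v} → PairShape C j i u v → Killed s q u v
      by-shape column-j     = kills-j K
      by-shape column-i     = kills-i K
      by-shape column-left  = kills-left K
      by-shape column-right = kills-right K
      by-shape column-far   = killed-zero s q

    -- Conversely each shape occurs: at columns j and i, and at j-1 and i+1 (giving x and y)
    -- unless that neighbour is missing and x or y is 0.
    columns⇒kills : ∀ q → ColumnsKilled q → Kills s a b x y q
    columns⇒kills q K = kills (at (diag C j) refl (K j)) (at refl (diag C i) (K i)) left right
      where
      at : ∀ {u v u′ v′} → u ≡ u′ → v ≡ v′ → Killed s q u v → Killed s q u′ v′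
      at refl refl k = k
      left : Killed s q x (+ 0)
      left with mL-entry C j
      ... | inj₁ x≡0 = at (sym x≡0) refl (killed-zero s q)
      ... | inj₂ (c , c→j , mjc≡x) =
        at mjc≡x (far-left-zero C i c (ℕₚ.≤-reflexive (trans (cong suc c→j) j→i))) (K c)
      right : Killed s q (+ 0) y
      right with mR-entry C i
      ... | inj₁ y≡0 = at refl (sym y≡0) (killed-zero s q)
      ... | inj₂ (c , i→c , mic≡y) =
        at (far-right-zero C j c (ℕₚ.≤-reflexive (sym (trans i→c (cong suc (sym j→i)))))) mic≡y (K c)

    private
      j≢i : ¬ j ≡ i
      j≢i refl = ℕₚ.m≢1+n+m (toℕ j) {0} (sym j→i)

    power≈I⇒kills : ∀ k → (A ^ k) ≈[ s ] I → Kills s a b x y (powCoeffs a b k)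
    power≈I⇒kills k Aᵏ≈I = columns⇒kills (powCoeffs a b k)
      (Rank2≈I⇒ j i _ _ j≢i (≈I-resp (pair-power C j i k) Aᵏ≈I))

    kills⇒power≈I : ∀ k → Kills s a b x y (powCoeffs a b k) → (A ^ k) ≈[ s ] I
    kills⇒power≈I k K = ≈I-resp (λ l c → sym (pair-power C j i k l c))
      (Rank2≈I j i _ _ (kills⇒columns (powCoeffs a b k) K))

    period-transfer : ∀ {q} → ArithPeriod s a b x y q → HasPeriod s A q
    period-transfer = Least-transfer kills⇒power≈I power≈I⇒kills

    period-transfer⁻ : ∀ {q} → HasPeriod s A q → ArithPeriod s a b x y q
    period-transfer⁻ = Least-transfer power≈I⇒kills kills⇒power≈I

  not-divisible : ∀ {s z} → 1 ℕ.≤ ℤ.∣ z ∣ → ℤ.∣ z ∣ ℕ.< s → ¬ s ∣ᶻ z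
  not-divisible 1≤∣z∣ ∣z∣<s s∣z =
    ℕₚ.<⇒≱ ∣z∣<s (ℕ∣.∣⇒≤ ⦃ ℕ.>-nonZero 1≤∣z∣ ⦄ (ℤ∣.∣⇒∣ᵤ s∣z))

  kills-by-coeffs : ∀ {s a b x y} q → s ∣ᶻ P q → s ∣ᶻ Q q → s ∣ᶻ R q → s ∣ᶻ T q → Kills s a b x y q
  kills-by-coeffs q s∣P s∣Q s∣R s∣T = kills (column _ _) (column _ _) (column _ _) (column _ _)
    where
    column : ∀ u v → Killed _ q u v
    column u v = ℤ∣.∣m∣n⇒∣m+n (ℤ∣.∣m⇒∣m*n u s∣P) (ℤ∣.∣m⇒∣m*n v s∣Q) ,
                 ℤ∣.∣m∣n⇒∣m+n (ℤ∣.∣m⇒∣m*n u s∣R) (ℤ∣.∣m⇒∣m*n v s∣T)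

  kills-zero : ∀ {s a b x y} → Kills s a b x y (coeffs (+ 0) (+ 0) (+ 0) (+ 0))
  kills-zero {s} = kills-by-coeffs _ (∣ᶻ0 s) (∣ᶻ0 s) (∣ᶻ0 s) (∣ᶻ0 s)

  -- Finite labels, s > 2 (s ≥ 2 for label 3): the coefficients vanish after p steps, and
  -- at each earlier step some killing condition reads s ∣ ±1 or s ∣ ±2.
  period-00 : ∀ {s x y} → 3 ℕ.≤ s → ArithPeriod s (+ 0) (+ 0) x y 2
  period-00 s≥3 = s≤s z≤n , kills-zero ,
    λ { 1 _ _ K → not-divisible (s≤s z≤n) s≥3 (proj₁ (kills-j K))
      ; (suc (suc k)) _ (s≤s (s≤s ())) }

  period-11 : ∀ {s x y} → 2 ℕ.≤ s → ArithPeriod s (+ 1) (+ 1) x y 3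
  period-11 s≥2 = s≤s z≤n , kills-zero ,
    λ { 1 _ _ K → not-divisible (s≤s z≤n) s≥2 (proj₁ (kills-j K))
      ; 2 _ _ K → not-divisible (s≤s z≤n) s≥2 (proj₁ (kills-i K))
      ; (suc (suc (suc k))) _ (s≤s (s≤s (s≤s ()))) }

  period-12 : ∀ {s x y} → 3 ℕ.≤ s → ArithPeriod s (+ 1) (+ 2) x y 4
  period-12 s≥3 = s≤s z≤n , kills-zero ,
    λ { 1 _ _ K → not-divisible (s≤s z≤n) (ℕₚ.<⇒≤ s≥3) (proj₁ (kills-i K))
      ; 2 _ _ K → not-divisible (s≤s z≤n) s≥3 (proj₁ (kills-j K))
      ; 3 _ _ K → not-divisible (s≤s z≤n) (ℕₚ.<⇒≤ s≥3) (proj₁ (kills-i K))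
      ; (suc (suc (suc (suc k)))) _ (s≤s (s≤s (s≤s (s≤s ())))) }

  period-21 : ∀ {s x y} → 3 ℕ.≤ s → ArithPeriod s (+ 2) (+ 1) x y 4
  period-21 s≥3 = s≤s z≤n , kills-zero ,
    λ { 1 _ _ K → not-divisible (s≤s z≤n) (ℕₚ.<⇒≤ s≥3) (proj₂ (kills-j K))
      ; 2 _ _ K → not-divisible (s≤s z≤n) s≥3 (proj₁ (kills-j K))
      ; 3 _ _ K → not-divisible (s≤s z≤n) (ℕₚ.<⇒≤ s≥3) (proj₂ (kills-j K))
      ; (suc (suc (suc (suc k)))) _ (s≤s (s≤s (s≤s (s≤s ())))) }

  period-13 : ∀ {s x y} → 3 ℕ.≤ s → ArithPeriod s (+ 1) (+ 3) x y 6
  period-13 s≥3 = s≤s z≤n , kills-zero ,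
    λ { 1 _ _ K → not-divisible (s≤s z≤n) (ℕₚ.<⇒≤ s≥3) (proj₁ (kills-j K))
      ; 2 _ _ K → not-divisible (s≤s z≤n) (ℕₚ.<⇒≤ s≥3) (proj₁ (kills-i K))
      ; 3 _ _ K → not-divisible (s≤s z≤n) s≥3 (proj₁ (kills-j K))
      ; 4 _ _ K → not-divisible (s≤s z≤n) (ℕₚ.<⇒≤ s≥3) (proj₁ (kills-i K))
      ; 5 _ _ K → not-divisible (s≤s z≤n) (ℕₚ.<⇒≤ s≥3) (proj₁ (kills-i K))
      ; (suc (suc (suc (suc (suc (suc k)))))) _ (s≤s (s≤s (s≤s (s≤s (s≤s (s≤s ())))))) }

  period-31 : ∀ {s x y} → 3 ℕ.≤ s → ArithPeriod s (+ 3) (+ 1) x y 6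
  period-31 s≥3 = s≤s z≤n , kills-zero ,
    λ { 1 _ _ K → not-divisible (s≤s z≤n) (ℕₚ.<⇒≤ s≥3) (proj₁ (kills-j K))
      ; 2 _ _ K → not-divisible (s≤s z≤n) (ℕₚ.<⇒≤ s≥3) (proj₂ (kills-j K))
      ; 3 _ _ K → not-divisible (s≤s z≤n) s≥3 (proj₁ (kills-j K))
      ; 4 _ _ K → not-divisible (s≤s z≤n) (ℕₚ.<⇒≤ s≥3) (proj₂ (kills-j K))
      ; 5 _ _ K → not-divisible (s≤s z≤n) (ℕₚ.<⇒≤ s≥3) (proj₂ (kills-j K))
      ; (suc (suc (suc (suc (suc (suc k)))))) _ (s≤s (s≤s (s≤s (s≤s (s≤s (s≤s ())))))) }

  -- Evenness: the node types use EvenZ z = 2 ∣ |z| (over ℕ), the arithmetic uses 2 ∣ᶻ z.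
  two∣ : ∀ w → 2 ∣ᶻ + 2 * w
  two∣ w = ℤ∣.∣m⇒∣m*n w (divides (+ 1) refl)

  two∣-even : ∀ {z} → EvenZ z → 2 ∣ᶻ z
  two∣-even = ℤ∣.∣ᵤ⇒∣

  even-two∣ : ∀ {z} → 2 ∣ᶻ z → EvenZ z
  even-two∣ = ℤ∣.∣⇒∣ᵤ

  -- Labels 3 and 6 modulo 2: the coefficients are all even after three steps.
  period-13-mod2 : ∀ {x y} → ArithPeriod 2 (+ 1) (+ 3) x y 3
  period-13-mod2 = s≤s z≤n ,
    kills-by-coeffs _ (divides (+ 2) refl) (divides (+ 1) refl) (divides (+ 3) refl) (divides (+ 2) refl) ,
    λ { 1 _ _ K → not-divisible (s≤s z≤n) (s≤s (s≤s z≤n)) (proj₁ (kills-j K))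
      ; 2 _ _ K → not-divisible (s≤s z≤n) (s≤s (s≤s z≤n)) (proj₁ (kills-i K))
      ; (suc (suc (suc k))) _ (s≤s (s≤s (s≤s ()))) }

  period-31-mod2 : ∀ {x y} → ArithPeriod 2 (+ 3) (+ 1) x y 3
  period-31-mod2 = s≤s z≤n ,
    kills-by-coeffs _ (divides (+ 2) refl) (divides (+ 3) refl) (divides (+ 1) refl) (divides (+ 2) refl) ,
    λ { 1 _ _ K → not-divisible (s≤s z≤n) (s≤s (s≤s z≤n)) (proj₁ (kills-j K))
      ; 2 _ _ K → not-divisible (s≤s z≤n) (s≤s (s≤s z≤n)) (proj₂ (kills-j K))
      ; (suc (suc (suc k))) _ (s≤s (s≤s (s≤s ()))) }

  period-12-mod2 : ∀ {x y} → (EvenZ y → ArithPeriod 2 (+ 1) (+ 2) x y 2)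
                             × (¬ EvenZ y → ArithPeriod 2 (+ 1) (+ 2) x y 4)
  period-12-mod2 {x} {y} =
    (λ y-even → s≤s z≤n ,
       kills (divides -[1+ 0 ] refl , divides (+ 0) refl) (divides (+ 0) refl , divides -[1+ 0 ] refl)
             (even-left , even-left)
             (ℤ∣.∣m∣n⇒∣m+n (∣ᶻ0 2) (ℤ∣.∣n⇒∣m*n (+ 1) (two∣-even {y} y-even)) ,
              ℤ∣.∣m∣n⇒∣m+n (∣ᶻ0 2) (two∣ y)) ,
       λ { 1 _ _ K → not-divisible (s≤s z≤n) (s≤s (s≤s z≤n)) (proj₁ (kills-i K))
         ; (suc (suc k)) _ (s≤s (s≤s ())) }) ,
    (λ y-odd → s≤s z≤n , kills-zero ,
       λ { 1 _ _ K → not-divisible (s≤s z≤n) (s≤s (s≤s z≤n)) (proj₁ (kills-i K))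
         ; 2 _ _ K → y-odd (even-two∣ (subst (2 ∣ᶻ_) (only-y y) (proj₁ (kills-right K))))
         ; 3 _ _ K → not-divisible (s≤s z≤n) (s≤s (s≤s z≤n)) (proj₁ (kills-i K))
         ; (suc (suc (suc (suc k)))) _ (s≤s (s≤s (s≤s (s≤s ())))) })
    where
    even-left : 2 ∣ᶻ + 2 * x + + 0
    even-left = ℤ∣.∣m∣n⇒∣m+n (two∣ x) (∣ᶻ0 2)
    only-y : ∀ y → + 2 * + 0 + + 1 * y ≡ y
    only-y = solve-∀

  period-21-mod2 : ∀ {x y} → (EvenZ x → ArithPeriod 2 (+ 2) (+ 1) x y 2)
                             × (¬ EvenZ x → ArithPeriod 2 (+ 2) (+ 1) x y 4)
  period-21-mod2 {x} {y} =
    (λ x-even → s≤s z≤n ,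
       kills (divides -[1+ 0 ] refl , divides (+ 0) refl) (divides (+ 0) refl , divides -[1+ 0 ] refl)
             (ℤ∣.∣m∣n⇒∣m+n (two∣ x) (∣ᶻ0 2) ,
              ℤ∣.∣m∣n⇒∣m+n (ℤ∣.∣n⇒∣m*n (+ 1) (two∣-even {x} x-even)) (∣ᶻ0 2))
             (even-right , even-right) ,
       λ { 1 _ _ K → not-divisible (s≤s z≤n) (s≤s (s≤s z≤n)) (proj₂ (kills-j K))
         ; (suc (suc k)) _ (s≤s (s≤s ())) }) ,
    (λ x-odd → s≤s z≤n , kills-zero ,
       λ { 1 _ _ K → not-divisible (s≤s z≤n) (s≤s (s≤s z≤n)) (proj₂ (kills-j K))
         ; 2 _ _ K → x-odd (even-two∣ (subst (2 ∣ᶻ_) (only-x x) (proj₂ (kills-left K))))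
         ; 3 _ _ K → not-divisible (s≤s z≤n) (s≤s (s≤s z≤n)) (proj₂ (kills-j K))
         ; (suc (suc (suc (suc k)))) _ (s≤s (s≤s (s≤s (s≤s ())))) })
    where
    even-right : 2 ∣ᶻ + 0 + + 2 * y
    even-right = ℤ∣.∣m∣n⇒∣m+n (∣ᶻ0 2) (two∣ y)
    only-x : ∀ x → + 1 * x + + 2 * + 0 ≡ x
    only-x = solve-∀

  period-00-mod2 : ∀ {x y} → (Kills 2 (+ 0) (+ 0) x y (powCoeffs (+ 0) (+ 0) 1) → EvenZ x × EvenZ y)
                             × (EvenZ x → EvenZ y → ArithPeriod 2 (+ 0) (+ 0) x y 1)
  period-00-mod2 {x} {y} =
    (λ K → even-two∣ (subst (2 ∣ᶻ_) (only-x x) (proj₁ (kills-left K))) ,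
           even-two∣ (subst (2 ∣ᶻ_) (only-y y) (proj₂ (kills-right K)))) ,
    (λ x-even y-even → s≤s z≤n ,
       kills (divides -[1+ 0 ] refl , divides (+ 0) refl) (divides (+ 0) refl , divides -[1+ 0 ] refl)
             (ℤ∣.∣m∣n⇒∣m+n (ℤ∣.∣n⇒∣m*n (+ 1) (two∣-even {x} x-even)) (∣ᶻ0 2) , ∣ᶻ0 2)
             (∣ᶻ0 2 , ℤ∣.∣m∣n⇒∣m+n (∣ᶻ0 2) (ℤ∣.∣n⇒∣m*n (+ 1) (two∣-even {y} y-even))) ,
       λ { (suc k) _ (s≤s ()) })
    where
    only-x : ∀ x → + 1 * x + + 0 * + 0 ≡ x
    only-x = solve-∀
    only-y : ∀ y → + 0 * + 0 + + 1 * y ≡ y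
    only-y = solve-∀

  unique-multiple : ∀ {s k} → 1 ℕ.≤ k → k ℕ.< 2 ℕ.* s → s ∣ᶻ + k → k ≡ s
  unique-multiple {s} {k} 1≤k k<2s s∣k with ℤ∣.∣⇒∣ᵤ s∣k
  ... | ℕ∣.divides zero k≡0 = ⊥-elim (ℕₚ.<⇒≱ 1≤k (ℕₚ.≤-reflexive k≡0))
  ... | ℕ∣.divides (suc zero) k≡s = trans k≡s (ℕₚ.+-identityʳ s)
  ... | ℕ∣.divides (suc (suc q)) k≡q*s =
    ⊥-elim (ℕₚ.<⇒≱ k<2s (subst (2 ℕ.* s ℕ.≤_) (sym k≡q*s) (ℕₚ.+-monoʳ-≤ s (ℕₚ.+-monoʳ-≤ s z≤n))))

  odd-form : ∀ s → ¬ 2 ℕ∣.∣ s → Σ ℕ (λ h → s ≡ suc (h ℕ.+ h))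
  odd-form zero ¬2∣s = ⊥-elim (¬2∣s (ℕ∣._∣0 2))
  odd-form (suc zero) _ = 0 , refl
  odd-form (suc (suc s)) ¬2∣s with odd-form s (λ 2∣s → ¬2∣s (ℕ∣.∣m∣n⇒∣m+n (ℕ∣.∣-refl {2}) 2∣s))
  ... | h , refl = suc h , cong (suc ∘′ suc) (sym (ℕₚ.+-suc h h))

  two-swap : ∀ s w → s * (w * + 2) ≡ + 2 * (w * s)
  two-swap = solve-∀

  halve : ∀ {s N M} → + 2 * N ≡ + s * M → 2 ∣ᶻ M → s ∣ᶻ N
  halve {s} {N} {M} 2N≡sM (divides w M≡2w) = divides w (ℤₚ.*-cancelˡ-≡ (+ 2) N (w * + s) (begin
    + 2 * N         ≡⟨ 2N≡sM ⟩
    + s * M         ≡⟨ cong (+ s *_) M≡2w ⟩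
    + s * (w * + 2) ≡⟨ two-swap (+ s) w ⟩
    + 2 * (w * + s) ∎))

  unhalve : ∀ {s N M} → 1 ℕ.≤ s → + 2 * N ≡ + s * M → s ∣ᶻ N → 2 ∣ᶻ M
  unhalve {s} {N} {M} 1≤s 2N≡sM (divides w N≡ws) =
    divides w (sym (ℤₚ.*-cancelˡ-≡ (+ s) (w * + 2) M ⦃ ℕ.>-nonZero 1≤s ⦄ (begin
      + s * (w * + 2) ≡⟨ two-swap (+ s) w ⟩
      + 2 * (w * + s) ≡⟨ cong (+ 2 *_) N≡ws ⟨
      + 2 * N         ≡⟨ 2N≡sM ⟩
      + s * M         ∎)))

  -- Triangular numbers t_k = k(k-1)/2, as integers: they enter the closed forms of the
  -- coefficients for the affine labels (products of Cartan integers equal to 4).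
  tri : ℕ → ℤ
  tri zero    = + 0
  tri (suc k) = tri k + + k

  tri-double : ∀ k → + 2 * tri k ≡ + k * (+ k - + 1)
  tri-double zero    = refl
  tri-double (suc k) = begin
    + 2 * (tri k + + k)           ≡⟨ ℤₚ.*-distribˡ-+ (+ 2) (tri k) (+ k) ⟩
    + 2 * tri k + + 2 * + k       ≡⟨ cong (_+ + 2 * + k) (tri-double k) ⟩
    + k * (+ k - + 1) + + 2 * + k ≡⟨ shift (+ k) ⟩
    (+ 1 + + k) * (+ 1 + + k - + 1) ∎
    where
    shift : ∀ K → K * (K - + 1) + + 2 * K ≡ (+ 1 + K) * (+ 1 + K - + 1)
    shift = solve-∀

  square-times : ∀ k z → (+ 2 * tri k + + k) * z ≡ + k * (+ k * z)
  square-times k z = begin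
    (+ 2 * tri k + + k) * z           ≡⟨ cong (λ u → (u + + k) * z) (tri-double k) ⟩
    (+ k * (+ k - + 1) + + k) * z     ≡⟨ regroup (+ k) z ⟩
    + k * (+ k * z)                   ∎
    where
    regroup : ∀ K z → (K * (K - + 1) + K) * z ≡ K * (K * z)
    regroup = solve-∀

  double-tri-times : ∀ k z → (+ 2 * tri k) * z ≡ (+ k - + 1) * (+ k * z)
  double-tri-times k z = begin
    (+ 2 * tri k) * z         ≡⟨ cong (_* z) (tri-double k) ⟩
    (+ k * (+ k - + 1)) * z   ≡⟨ regroup (+ k) z ⟩
    (+ k - + 1) * (+ k * z)   ∎
    where
    regroup : ∀ K z → (K * (K - + 1)) * z ≡ (K - + 1) * (K * z)
    regroup = solve-∀

  double-next-tri-times : ∀ k z → (+ 2 * (tri k + + k)) * z ≡ (+ k + + 1) * (+ k * z)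
  double-next-tri-times k z = begin
    (+ 2 * tri (suc k)) * z               ≡⟨ cong (_* z) (tri-double (suc k)) ⟩
    ((+ 1 + + k) * (+ 1 + + k - + 1)) * z ≡⟨ regroup (+ k) z ⟩
    (+ k + + 1) * (+ k * z)               ∎
    where
    regroup : ∀ K z → ((+ 1 + K) * (+ 1 + K - + 1)) * z ≡ (K + + 1) * (K * z)
    regroup = solve-∀

  multiple-of : ∀ {s m w} c → w ≡ c * m → s ∣ᶻ m → s ∣ᶻ w
  multiple-of {s} c w≡cm s∣m = subst (s ∣ᶻ_) (sym w≡cm) (ℤ∣.∣n⇒∣m*n c s∣m)

  times-zero : ∀ s u → s ∣ᶻ u * + 0
  times-zero s u = ℤ∣.∣n⇒∣m*n u (∣ᶻ0 s)

  closed-form : ∀ a b (f : ℕ → Coeffs) → f 0 ≡ coeffs (+ 0) (+ 0) (+ 0) (+ 0) →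
    (∀ k → next a b (f k) ≡ f (suc k)) → ∀ k → powCoeffs a b k ≡ f k
  closed-form a b f f₀ step zero    = sym f₀
  closed-form a b f f₀ step (suc k) = trans (cong (next a b) (closed-form a b f f₀ step k)) (step k)

  coeffs-≡ : ∀ {p q r t p′ q′ r′ t′} → p ≡ p′ → q ≡ q′ → r ≡ r′ → t ≡ t′ →
    coeffs p q r t ≡ coeffs p′ q′ r′ t′
  coeffs-≡ refl refl refl refl = refl

  coeffs-14 : ℕ → Coeffs
  coeffs-14 k = coeffs (+ 2 * t + K) (t + K) (+ 4 * t) (+ 2 * t + K)
    where t = tri k ; K = + k

  powCoeffs-14 : ∀ k → powCoeffs (+ 1) (+ 4) k ≡ coeffs-14 k
  powCoeffs-14 = closed-form (+ 1) (+ 4) coeffs-14 refl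
    (λ k → coeffs-≡ (stepP (tri k) (+ k)) (stepQ (tri k) (+ k)) (stepR (tri k) (+ k)) (stepT (tri k) (+ k)))
    where
    stepP : ∀ t K → + 1 + (+ 1 * + 4 - + 1) * (+ 2 * t + K) - + 1 * (+ 4 * t) ≡ + 2 * (t + K) + (+ 1 + K)
    stepP = solve-∀
    stepQ : ∀ t K → + 1 + (+ 1 * + 4 - + 1) * (t + K) - + 1 * (+ 2 * t + K) ≡ (t + K) + (+ 1 + K)
    stepQ = solve-∀
    stepR : ∀ t K → + 4 * (+ 2 * t + K) - + 4 * t ≡ + 4 * (t + K)
    stepR = solve-∀
    stepT : ∀ t K → + 1 + + 4 * (t + K) - (+ 2 * t + K) ≡ + 2 * (t + K) + (+ 1 + K)
    stepT = solve-∀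

  kills-14⇒ : ∀ {s x y} k → Kills s (+ 1) (+ 4) x y (powCoeffs (+ 1) (+ 4) k) →
    s ∣ᶻ + k × s ∣ᶻ tri (suc k) * y
  kills-14⇒ {s} {x} {y} k Kₖ with subst (Kills s (+ 1) (+ 4) x y) (powCoeffs-14 k) Kₖ
  ... | kills _ (i₁ , _) _ (y₁ , _) =
    subst (s ∣ᶻ_) (ℤₚ.neg-involutive (+ k)) (ℤ∣.∣m⇒∣-m (subst (s ∣ᶻ_) (entry-i (tri k) (+ k)) i₁)) ,
    ℤ∣.∣m+n∣m⇒∣n y₁ (times-zero s (+ 2 * tri k + + k))
    where
    entry-i : ∀ t K → (+ 2 * t + K) * + 1 + (t + K) * - + 2 ≡ - K
    entry-i = solve-∀

  ⇒kills-14 : ∀ {s x y} k → s ∣ᶻ + k → s ∣ᶻ tri (suc k) * y →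
    Kills s (+ 1) (+ 4) x y (powCoeffs (+ 1) (+ 4) k)
  ⇒kills-14 {s} {x} {y} k s∣k s∣ty = subst (Kills s (+ 1) (+ 4) x y) (sym (powCoeffs-14 k)) (kills
    (multiple-of (+ 2) (entry-j₁ t K) s∣k , multiple-of (+ 4) (entry-j₂ t K) s∣k)
    (multiple-of (- + 1) (entry-i₁ t K) s∣k , multiple-of (- + 2) (entry-i₂ t K) s∣k)
    (ℤ∣.∣m∣n⇒∣m+n (multiple-of K (square-times k x) (ℤ∣.∣m⇒∣m*n x s∣k)) (times-zero s (t + K)) ,
     ℤ∣.∣m∣n⇒∣m+n (multiple-of (+ 2) (four-t t x) (multiple-of (K - + 1) (double-tri-times k x) (ℤ∣.∣m⇒∣m*n x s∣k)))
                   (times-zero s (+ 2 * t + K)))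
    (ℤ∣.∣m∣n⇒∣m+n (times-zero s (+ 2 * t + K)) s∣ty ,
     ℤ∣.∣m∣n⇒∣m+n (times-zero s (+ 4 * t)) (multiple-of K (square-times k y) (ℤ∣.∣m⇒∣m*n y s∣k))))
    where
    t = tri k
    K = + k
    entry-j₁ : ∀ t K → (+ 2 * t + K) * - + 2 + (t + K) * + 4 ≡ + 2 * K
    entry-j₁ = solve-∀
    entry-j₂ : ∀ t K → (+ 4 * t) * - + 2 + (+ 2 * t + K) * + 4 ≡ + 4 * K
    entry-j₂ = solve-∀
    entry-i₁ : ∀ t K → (+ 2 * t + K) * + 1 + (t + K) * - + 2 ≡ - + 1 * K
    entry-i₁ = solve-∀
    entry-i₂ : ∀ t K → (+ 4 * t) * + 1 + (+ 2 * t + K) * - + 2 ≡ - + 2 * K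
    entry-i₂ = solve-∀
    four-t : ∀ t x → (+ 4 * t) * x ≡ + 2 * ((+ 2 * t) * x)
    four-t = solve-∀

  coeffs-41 : ℕ → Coeffs
  coeffs-41 k = coeffs (+ 2 * t + K) (+ 4 * (t + K)) t (+ 2 * t + K)
    where t = tri k ; K = + k

  powCoeffs-41 : ∀ k → powCoeffs (+ 4) (+ 1) k ≡ coeffs-41 k
  powCoeffs-41 = closed-form (+ 4) (+ 1) coeffs-41 refl
    (λ k → coeffs-≡ (stepP (tri k) (+ k)) (stepQ (tri k) (+ k)) (stepR (tri k) (+ k)) (stepT (tri k) (+ k)))
    where
    stepP : ∀ t K → + 1 + (+ 4 * + 1 - + 1) * (+ 2 * t + K) - + 4 * t ≡ + 2 * (t + K) + (+ 1 + K)
    stepP = solve-∀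
    stepQ : ∀ t K → + 4 + (+ 4 * + 1 - + 1) * (+ 4 * (t + K)) - + 4 * (+ 2 * t + K) ≡ + 4 * ((t + K) + (+ 1 + K))
    stepQ = solve-∀
    stepR : ∀ t K → + 1 * (+ 2 * t + K) - t ≡ t + K
    stepR = solve-∀
    stepT : ∀ t K → + 1 + + 1 * (+ 4 * (t + K)) - (+ 2 * t + K) ≡ + 2 * (t + K) + (+ 1 + K)
    stepT = solve-∀

  kills-41⇒ : ∀ {s x y} k → Kills s (+ 4) (+ 1) x y (powCoeffs (+ 4) (+ 1) k) →
    s ∣ᶻ + k × s ∣ᶻ tri k * x
  kills-41⇒ {s} {x} {y} k Kₖ with subst (Kills s (+ 4) (+ 1) x y) (powCoeffs-41 k) Kₖ
  ... | kills (_ , j₂) _ (_ , x₂) _ =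
    subst (s ∣ᶻ_) (entry-j₂ (tri k) (+ k)) j₂ ,
    ℤ∣.∣m+n∣n⇒∣m x₂ (times-zero s (+ 2 * tri k + + k))
    where
    entry-j₂ : ∀ t K → t * - + 2 + (+ 2 * t + K) * + 1 ≡ K
    entry-j₂ = solve-∀

  ⇒kills-41 : ∀ {s x y} k → s ∣ᶻ + k → s ∣ᶻ tri k * x →
    Kills s (+ 4) (+ 1) x y (powCoeffs (+ 4) (+ 1) k)
  ⇒kills-41 {s} {x} {y} k s∣k s∣tx = subst (Kills s (+ 4) (+ 1) x y) (sym (powCoeffs-41 k)) (kills
    (multiple-of (+ 2) (entry-j₁ t K) s∣k , multiple-of (+ 1) (entry-j₂ t K) s∣k)
    (multiple-of (- + 4) (entry-i₁ t K) s∣k , multiple-of (- + 2) (entry-i₂ t K) s∣k)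
    (ℤ∣.∣m∣n⇒∣m+n (multiple-of K (square-times k x) (ℤ∣.∣m⇒∣m*n x s∣k)) (times-zero s (+ 4 * (t + K))) ,
     ℤ∣.∣m∣n⇒∣m+n s∣tx (times-zero s (+ 2 * t + K)))
    (ℤ∣.∣m∣n⇒∣m+n (times-zero s (+ 2 * t + K))
                   (multiple-of (+ 2) (four-next t K y)
                     (multiple-of (K + + 1) (double-next-tri-times k y) (ℤ∣.∣m⇒∣m*n y s∣k))) ,
     ℤ∣.∣m∣n⇒∣m+n (times-zero s t) (multiple-of K (square-times k y) (ℤ∣.∣m⇒∣m*n y s∣k))))
    where
    t = tri k
    K = + k
    entry-j₁ : ∀ t K → (+ 2 * t + K) * - + 2 + (+ 4 * (t + K)) * + 1 ≡ + 2 * K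
    entry-j₁ = solve-∀
    entry-j₂ : ∀ t K → t * - + 2 + (+ 2 * t + K) * + 1 ≡ + 1 * K
    entry-j₂ = solve-∀
    entry-i₁ : ∀ t K → (+ 2 * t + K) * + 4 + (+ 4 * (t + K)) * - + 2 ≡ - + 4 * K
    entry-i₁ = solve-∀
    entry-i₂ : ∀ t K → t * + 4 + (+ 2 * t + K) * - + 2 ≡ - + 2 * K
    entry-i₂ = solve-∀
    four-next : ∀ t K y → (+ 4 * (t + K)) * y ≡ + 2 * ((+ 2 * (t + K)) * y)
    four-next = solve-∀

  coeffs-22 : ℕ → Coeffs
  coeffs-22 k = coeffs (+ 2 * t + K) (+ 2 * (t + K)) (+ 2 * t) (+ 2 * t + K)
    where t = tri k ; K = + k

  powCoeffs-22 : ∀ k → powCoeffs (+ 2) (+ 2) k ≡ coeffs-22 k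
  powCoeffs-22 = closed-form (+ 2) (+ 2) coeffs-22 refl
    (λ k → coeffs-≡ (stepP (tri k) (+ k)) (stepQ (tri k) (+ k)) (stepR (tri k) (+ k)) (stepT (tri k) (+ k)))
    where
    stepP : ∀ t K → + 1 + (+ 2 * + 2 - + 1) * (+ 2 * t + K) - + 2 * (+ 2 * t) ≡ + 2 * (t + K) + (+ 1 + K)
    stepP = solve-∀
    stepQ : ∀ t K → + 2 + (+ 2 * + 2 - + 1) * (+ 2 * (t + K)) - + 2 * (+ 2 * t + K) ≡ + 2 * ((t + K) + (+ 1 + K))
    stepQ = solve-∀
    stepR : ∀ t K → + 2 * (+ 2 * t + K) - + 2 * t ≡ + 2 * (t + K)
    stepR = solve-∀
    stepT : ∀ t K → + 1 + + 2 * (+ 2 * (t + K)) - (+ 2 * t + K) ≡ + 2 * (t + K) + (+ 1 + K)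
    stepT = solve-∀

  Cond-22 : ℕ → ℤ → ℤ → ℕ → Set
  Cond-22 s x y k = s ∣ᶻ + 2 * + k × s ∣ᶻ + k * x × s ∣ᶻ + k * y

  kills-22⇒ : ∀ {s x y} k → Kills s (+ 2) (+ 2) x y (powCoeffs (+ 2) (+ 2) k) → Cond-22 s x y k
  kills-22⇒ {s} {x} {y} k Kₖ with subst (Kills s (+ 2) (+ 2) x y) (powCoeffs-22 k) Kₖ
  ... | kills (j₁ , _) _ (x₁ , x₂) (y₁ , y₂) =
    subst (s ∣ᶻ_) (entry-j₁ (tri k) (+ k)) j₁ ,
    subst (s ∣ᶻ_) (difference-x (tri k) (+ k) x) (ℤ∣.∣m∣n⇒∣m-n x₁ x₂) ,
    subst (s ∣ᶻ_) (difference-y (tri k) (+ k) y) (ℤ∣.∣m∣n⇒∣m-n y₁ y₂)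
    where
    entry-j₁ : ∀ t K → (+ 2 * t + K) * - + 2 + (+ 2 * (t + K)) * + 2 ≡ + 2 * K
    entry-j₁ = solve-∀
    difference-x : ∀ t K x → ((+ 2 * t + K) * x + (+ 2 * (t + K)) * + 0) - ((+ 2 * t) * x + (+ 2 * t + K) * + 0) ≡ K * x
    difference-x = solve-∀
    difference-y : ∀ t K y → ((+ 2 * t + K) * + 0 + (+ 2 * (t + K)) * y) - ((+ 2 * t) * + 0 + (+ 2 * t + K) * y) ≡ K * y
    difference-y = solve-∀

  ⇒kills-22 : ∀ {s x y} k → Cond-22 s x y k → Kills s (+ 2) (+ 2) x y (powCoeffs (+ 2) (+ 2) k)
  ⇒kills-22 {s} {x} {y} k (s∣2k , s∣kx , s∣ky) = subst (Kills s (+ 2) (+ 2) x y) (sym (powCoeffs-22 k)) (kills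
    (multiple-of (+ 1) (entry-j₁ t K) s∣2k , multiple-of (+ 1) (entry-j₂ t K) s∣2k)
    (multiple-of (- + 1) (entry-i₁ t K) s∣2k , multiple-of (- + 1) (entry-i₂ t K) s∣2k)
    (ℤ∣.∣m∣n⇒∣m+n (multiple-of K (square-times k x) s∣kx) (times-zero s (+ 2 * (t + K))) ,
     ℤ∣.∣m∣n⇒∣m+n (multiple-of (K - + 1) (double-tri-times k x) s∣kx) (times-zero s (+ 2 * t + K)))
    (ℤ∣.∣m∣n⇒∣m+n (times-zero s (+ 2 * t + K)) (multiple-of (K + + 1) (double-next-tri-times k y) s∣ky) ,
     ℤ∣.∣m∣n⇒∣m+n (times-zero s (+ 2 * t)) (multiple-of K (square-times k y) s∣ky)))
    where
    t = tri k
    K = + k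
    entry-j₁ : ∀ t K → (+ 2 * t + K) * - + 2 + (+ 2 * (t + K)) * + 2 ≡ + 1 * (+ 2 * K)
    entry-j₁ = solve-∀
    entry-j₂ : ∀ t K → (+ 2 * t) * - + 2 + (+ 2 * t + K) * + 2 ≡ + 1 * (+ 2 * K)
    entry-j₂ = solve-∀
    entry-i₁ : ∀ t K → (+ 2 * t + K) * + 2 + (+ 2 * (t + K)) * - + 2 ≡ - + 1 * (+ 2 * K)
    entry-i₁ = solve-∀
    entry-i₂ : ∀ t K → (+ 2 * t) * + 2 + (+ 2 * t + K) * - + 2 ≡ - + 1 * (+ 2 * K)
    entry-i₂ = solve-∀

  -- Pairs (1,4) and (4,1): A^k ≡ I (mod s) iff s ∣ k and s ∣ N k, where 2·N k = k(k+e)·z for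
  -- an odd e.  The period is s, except 2s when s is even and z is odd.
  module OddAffine (s : ℕ) (s≥2 : 2 ℕ.≤ s) (e z : ℤ) (N : ℕ → ℤ) (1+e-even : 2 ∣ᶻ + 1 + e)
                   (N-double : ∀ k → + 2 * N k ≡ + k * ((+ k + e) * z)) where
    Cond : ℕ → Set
    Cond k = s ∣ᶻ + k × s ∣ᶻ N k

    private
      1≤s : 1 ℕ.≤ s
      1≤s = ℕₚ.<⇒≤ s≥2

      s∣s : s ∣ᶻ + s
      s∣s = divides (+ 1) (sym (ℤₚ.*-identityˡ (+ s)))

    period-s : (¬ 2 ℕ∣.∣ s ⊎ 2 ∣ᶻ z) → Least Cond s
    period-s odd-or-even =
      1≤s , (s∣s , halve (N-double s) (even-factor odd-or-even)) ,
      λ k 1≤k k<s (s∣k , _) → not-divisible 1≤k k<s s∣k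
      where
      -- (s + e)·z is even: e is odd, so s + e is even when s is odd.
      even-factor : (¬ 2 ℕ∣.∣ s ⊎ 2 ∣ᶻ z) → 2 ∣ᶻ (+ s + e) * z
      even-factor (inj₂ 2∣z) = ℤ∣.∣n⇒∣m*n (+ s + e) 2∣z
      even-factor (inj₁ s-odd) with odd-form s s-odd
      ... | h , s≡1+2h = ℤ∣.∣m⇒∣m*n z (subst (2 ∣ᶻ_) (sym (trans (cong (λ u → + u + e) s≡1+2h) (regroup (+ h) e)))
                                              (ℤ∣.∣m∣n⇒∣m+n 1+e-even (two∣ (+ h))))
        where
        regroup : ∀ h e → + 1 + (h + h) + e ≡ (+ 1 + e) + + 2 * h
        regroup = solve-∀

    period-2s : 2 ℕ∣.∣ s → ¬ 2 ∣ᶻ z → Least Cond (2 ℕ.* s)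
    period-2s 2∣s z-odd =
      ℕₚ.≤-trans 1≤s (ℕₚ.m≤m+n s (s ℕ.+ 0)) ,
      (divides (+ 2) (ℤₚ.pos-* 2 s) , halve double-N (two∣ _)) ,
      minimal
      where
      double-N : + 2 * N (2 ℕ.* s) ≡ + s * (+ 2 * ((+ (2 ℕ.* s) + e) * z))
      double-N = trans (N-double (2 ℕ.* s))
                       (trans (cong (_* ((+ (2 ℕ.* s) + e) * z)) (ℤₚ.pos-* 2 s)) (swap (+ s) _))
        where
        swap : ∀ S w → (+ 2 * S) * w ≡ S * (+ 2 * w)
        swap = solve-∀
      -- With s even, (s + e)·z even forces z even.
      z-even : 2 ∣ᶻ (+ s + e) * z → 2 ∣ᶻ z
      z-even 2∣s+e*z = subst (2 ∣ᶻ_) (ℤₚ.*-identityˡ z)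
        (ℤ∣.∣m+n∣n⇒∣m (subst (2 ∣ᶻ_) (ℤₚ.*-distribʳ-+ z (+ 1) e) (ℤ∣.∣m⇒∣m*n z 1+e-even)) 2∣ez)
        where
        2∣ez : 2 ∣ᶻ e * z
        2∣ez = ℤ∣.∣m+n∣m⇒∣n (subst (2 ∣ᶻ_) (ℤₚ.*-distribʳ-+ z (+ s) e) 2∣s+e*z)
                             (ℤ∣.∣m⇒∣m*n z (ℤ∣.∣ᵤ⇒∣ {i = + s} 2∣s))
      -- The only multiple of s below 2s is s, where N s is not divisible by s.
      minimal : ∀ k → 1 ℕ.≤ k → k ℕ.< 2 ℕ.* s → ¬ Cond k
      minimal k 1≤k k<2s (s∣k , s∣Nk) with unique-multiple 1≤k k<2s s∣k
      ... | refl = z-odd (z-even (unhalve 1≤s (N-double s) s∣Nk))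

  period-22-half : ∀ {s x y} → 2 ℕ∣.∣ s → 2 ∣ᶻ x → 2 ∣ᶻ y → 2 ℕ.≤ s → Least (Cond-22 s x y) (s ℕ./ 2)
  period-22-half {s} {x} {y} (ℕ∣.divides h s≡h*2) 2∣x 2∣y s≥2 =
    subst (Least (Cond-22 s x y)) (sym half) (1≤h , (divides (+ 1) (sym (trans (ℤₚ.*-identityˡ (+ s)) s≡2h)) ,
                                                       half-times x 2∣x , half-times y 2∣y) , minimal)
    where
    half : s ℕ./ 2 ≡ h
    half = trans (cong (ℕ._/ 2) s≡h*2) (m*n/n≡m h 2)
    s≡2h : + s ≡ + 2 * + h
    s≡2h = trans (cong +_ s≡h*2) (trans (ℤₚ.pos-* h 2) (ℤₚ.*-comm (+ h) (+ 2)))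
    1≤h : 1 ℕ.≤ h
    1≤h = positive h (subst (2 ℕ.≤_) s≡h*2 s≥2)
      where
      positive : ∀ h → 2 ℕ.≤ h ℕ.* 2 → 1 ℕ.≤ h
      positive (suc _) _ = s≤s z≤n
    half-times : ∀ z → 2 ∣ᶻ z → s ∣ᶻ + h * z
    half-times z (divides w z≡w*2) = divides w (begin
      + h * z         ≡⟨ cong (+ h *_) z≡w*2 ⟩
      + h * (w * + 2) ≡⟨ regroup (+ h) w ⟩
      w * (+ 2 * + h) ≡⟨ cong (w *_) s≡2h ⟨
      w * + s         ∎)
      where
      regroup : ∀ h w → h * (w * + 2) ≡ w * (+ 2 * h)
      regroup = solve-∀
    minimal : ∀ k → 1 ℕ.≤ k → k ℕ.< h → ¬ Cond-22 s x y k
    minimal k 1≤k k<h (s∣2k , _) =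
      not-divisible (ℕₚ.≤-trans 1≤k (ℕₚ.m≤m+n k (k ℕ.+ 0)))
                    (subst (2 ℕ.* k ℕ.<_) (trans (ℕₚ.*-comm 2 h) (sym s≡h*2)) (ℕₚ.*-monoʳ-< 2 k<h))
                    (subst (s ∣ᶻ_) (sym (ℤₚ.pos-* 2 k)) s∣2k)

  period-22 : ∀ {s x y} → 2 ℕ.≤ s → ¬ (2 ℕ∣.∣ s × 2 ∣ᶻ x × 2 ∣ᶻ y) → Least (Cond-22 s x y) s
  period-22 {s} {x} {y} s≥2 ¬half =
    ℕₚ.<⇒≤ s≥2 , (ℤ∣.∣n⇒∣m*n (+ 2) s∣s , ℤ∣.∣m⇒∣m*n x s∣s , ℤ∣.∣m⇒∣m*n y s∣s) , minimal
    where
    s∣s : s ∣ᶻ + s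
    s∣s = divides (+ 1) (sym (ℤₚ.*-identityˡ (+ s)))
    -- s ∣ 2k with k < s forces s = 2k, and then s ∣ kx, s ∣ ky make x and y even.
    minimal : ∀ k → 1 ℕ.≤ k → k ℕ.< s → ¬ Cond-22 s x y k
    minimal k 1≤k k<s (s∣2k , s∣kx , s∣ky) =
      ¬half (ℕ∣.divides k (trans (sym 2k≡s) (ℕₚ.*-comm 2 k)) , halve-k s∣kx , halve-k s∣ky)
      where
      2k≡s : 2 ℕ.* k ≡ s
      2k≡s = unique-multiple (ℕₚ.≤-trans 1≤k (ℕₚ.m≤m+n k (k ℕ.+ 0))) (ℕₚ.*-monoʳ-< 2 k<s)
                             (subst (s ∣ᶻ_) (sym (ℤₚ.pos-* 2 k)) s∣2k)
      halve-k : ∀ {z} → s ∣ᶻ + k * z → 2 ∣ᶻ z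
      halve-k {z} s∣kz = ℤ∣.*-cancelˡ-∣ (+ k) ⦃ ℕ.>-nonZero 1≤k ⦄
        (subst (ℤ∣._∣ + k * z) (trans (cong +_ (sym 2k≡s)) (trans (ℤₚ.pos-* 2 k) (ℤₚ.*-comm (+ 2) (+ k)))) s∣kz)

  N-double-14 : ∀ y k → + 2 * (tri (suc k) * y) ≡ + k * ((+ k + + 1) * y)
  N-double-14 y k = begin
    + 2 * (tri (suc k) * y)     ≡⟨ ℤₚ.*-assoc (+ 2) (tri (suc k)) y ⟨
    (+ 2 * tri (suc k)) * y     ≡⟨ double-next-tri-times k y ⟩
    (+ k + + 1) * (+ k * y)     ≡⟨ swap (+ k) y ⟩
    + k * ((+ k + + 1) * y)     ∎
    where
    swap : ∀ K y → (K + + 1) * (K * y) ≡ K * ((K + + 1) * y)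
    swap = solve-∀

  module Pair14 {s : ℕ} {x y : ℤ} (s≥2 : 2 ℕ.≤ s) where
    open OddAffine s s≥2 (+ 1) y (λ k → tri (suc k) * y) (divides (+ 1) refl) (N-double-14 y)

    as-period : ∀ {q} → Least Cond q → ArithPeriod s (+ 1) (+ 4) x y q
    as-period = Least-transfer (λ k (s∣k , s∣N) → ⇒kills-14 k s∣k s∣N) kills-14⇒

    period-14 : (¬ 2 ℕ∣.∣ s ⊎ 2 ∣ᶻ y) → ArithPeriod s (+ 1) (+ 4) x y s
    period-14 odd-or-even = as-period (period-s odd-or-even)

    period-14-double : 2 ℕ∣.∣ s → ¬ 2 ∣ᶻ y → ArithPeriod s (+ 1) (+ 4) x y (2 ℕ.* s)
    period-14-double 2∣s y-odd = as-period (period-2s 2∣s y-odd)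

  N-double-41 : ∀ x k → + 2 * (tri k * x) ≡ + k * ((+ k + - + 1) * x)
  N-double-41 x k = begin
    + 2 * (tri k * x)           ≡⟨ ℤₚ.*-assoc (+ 2) (tri k) x ⟨
    (+ 2 * tri k) * x           ≡⟨ double-tri-times k x ⟩
    (+ k - + 1) * (+ k * x)     ≡⟨ swap (+ k) x ⟩
    + k * ((+ k + - + 1) * x)   ∎
    where
    swap : ∀ K x → (K - + 1) * (K * x) ≡ K * ((K + - + 1) * x)
    swap = solve-∀

  module Pair41 {s : ℕ} {x y : ℤ} (s≥2 : 2 ℕ.≤ s) where
    open OddAffine s s≥2 (- + 1) x (λ k → tri k * x) (∣ᶻ0 2) (N-double-41 x)

    as-period : ∀ {q} → Least Cond q → ArithPeriod s (+ 4) (+ 1) x y q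
    as-period = Least-transfer (λ k (s∣k , s∣N) → ⇒kills-41 k s∣k s∣N) kills-41⇒

    period-41 : (¬ 2 ℕ∣.∣ s ⊎ 2 ∣ᶻ x) → ArithPeriod s (+ 4) (+ 1) x y s
    period-41 odd-or-even = as-period (period-s odd-or-even)

    period-41-double : 2 ℕ∣.∣ s → ¬ 2 ∣ᶻ x → ArithPeriod s (+ 4) (+ 1) x y (2 ℕ.* s)
    period-41-double 2∣s x-odd = as-period (period-2s 2∣s x-odd)

  period-22-arith : ∀ {s x y q} → Least (Cond-22 s x y) q → ArithPeriod s (+ 2) (+ 2) x y q
  period-22-arith = Least-transfer ⇒kills-22 kills-22⇒

  -- Node types in terms of the two Cartan integers m_{i,i-1}, m_{i,i+1} of the node;
  -- by definition EE C i = EENode (mL C i) (mR C i) and OE C i = OENode (mL C i) (mR C i).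
  EENode OENode : ℤ → ℤ → Set
  EENode u v = EvenZ u × EvenZ v
  OENode u v = (EvenZ u × OddZ v) ⊎ (OddZ u × EvenZ v)

  even-zero : EvenZ (+ 0)
  even-zero = ℕ∣.divides 0 refl

  even-two : EvenZ (+ 2)
  even-two = ℕ∣.divides 1 refl

  even-four : EvenZ (+ 4)
  even-four = ℕ∣.divides 2 refl

  odd-one : OddZ (+ 1)
  odd-one 2∣1 = ℕₚ.<⇒≱ (s≤s (s≤s z≤n)) (ℕ∣.∣⇒≤ 2∣1)

  ClaimC : ℕ → (ℕ → Set) → Label → Set → Set → Set
  ClaimC s Per p EEj EEi =
    (∀ q → p ≡ fin q → 2 ℕ.< s → Per q)
    × (s ≡ 2 → (p ≡ fin 3 ⊎ p ≡ fin 6) → Per 3)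
    × (s ≡ 2 → p ≡ fin 4 → ((EEj ⊎ EEi) → Per 2) × (¬ (EEj ⊎ EEi) → Per 4))
    × (s ≡ 2 → p ≡ fin 2 → (Per 1 → EEj × EEi) × (EEj × EEi → Per 1))

  Halved : ℕ → ℤ → ℤ → Set → Set → Set
  Halved s a b EEj EEi = a ≡ + 2 × b ≡ + 2 × EEj × EEi × 2 ℕ∣.∣ s

  Doubled : ℕ → ℤ → ℤ → Set → Set → Set
  Doubled s a b OEj OEi = ((a ≡ + 4 × b ≡ + 1 × OEj) ⊎ (b ≡ + 4 × a ≡ + 1 × OEi)) × 2 ℕ∣.∣ s

  ClaimD : ℕ → (ℕ → Set) → ℤ → ℤ → Label → Set → Set → Set → Set → Set
  ClaimD s Per a b p EEj OEj EEi OEi = p ≡ ∞ →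
    (Halved s a b EEj EEi → Per (s ℕ./ 2))
    × (Doubled s a b OEj OEi → Per (2 ℕ.* s))
    × (¬ Halved s a b EEj EEi → ¬ Doubled s a b OEj OEi → Per s)

  ClaimC-map : ∀ {s p EEj EEi} {Per Per′ : ℕ → Set} →
    (∀ {q} → Per q → Per′ q) → (∀ {q} → Per′ q → Per q) → ClaimC s Per p EEj EEi → ClaimC s Per′ p EEj EEi
  ClaimC-map to from (c₁ , c₂ , c₃ , c₄) =
    (λ q p≡q s>2 → to (c₁ q p≡q s>2)) , (λ s≡2 p≡ → to (c₂ s≡2 p≡)) ,
    (λ s≡2 p≡4 → (λ ee → to (proj₁ (c₃ s≡2 p≡4) ee)) , (λ ¬ee → to (proj₂ (c₃ s≡2 p≡4) ¬ee))) ,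
    (λ s≡2 p≡2 → (λ per → proj₁ (c₄ s≡2 p≡2) (from per)) , (λ ee → to (proj₂ (c₄ s≡2 p≡2) ee)))

  ClaimD-map : ∀ {s a b p EEj OEj EEi OEi} {Per Per′ : ℕ → Set} →
    (∀ {q} → Per q → Per′ q) → ClaimD s Per a b p EEj OEj EEi OEi → ClaimD s Per′ a b p EEj OEj EEi OEi
  ClaimD-map to claim p≡∞ with claim p≡∞
  ... | d₁ , d₂ , d₃ = (λ h → to (d₁ h)) , (λ h → to (d₂ h)) , (λ ¬h₁ ¬h₂ → to (d₃ ¬h₁ ¬h₂))

  edge-claim-C : ∀ {a b} → AllowedPair a b → ∀ x y s → 2 ℕ.≤ s →
    ClaimC s (ArithPeriod s a b x y) (labelOf ℤ.∣ a * b ∣) (EENode x a) (EENode b y)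
  edge-claim-C p00 x y s s≥2 =
    (λ { .2 refl s>2 → period-00 s>2 }) , (λ _ → λ { (inj₁ ()) ; (inj₂ ()) }) , (λ _ ()) ,
    λ { refl refl →
        (λ (_ , K₁ , _) → (proj₁ (proj₁ period-00-mod2 K₁) , even-zero) , (even-zero , proj₂ (proj₁ period-00-mod2 K₁))) ,
        (λ ((x-even , _) , (_ , y-even)) → proj₂ period-00-mod2 x-even y-even) }
  edge-claim-C p11 x y s s≥2 =
    (λ { .3 refl _ → period-11 s≥2 }) , (λ { refl _ → period-11 s≥2 }) , (λ _ ()) , (λ _ ())
  edge-claim-C p12 x y s s≥2 =
    (λ { .4 refl s>2 → period-12 s>2 }) , (λ _ → λ { (inj₁ ()) ; (inj₂ ()) }) ,
    (λ { refl refl →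
         (λ { (inj₁ (_ , 1-even)) → ⊥-elim (odd-one 1-even) ; (inj₂ (_ , y-even)) → proj₁ period-12-mod2 y-even }) ,
         (λ ¬ee → proj₂ period-12-mod2 (λ y-even → ¬ee (inj₂ (even-two , y-even)))) }) ,
    (λ _ ())
  edge-claim-C p21 x y s s≥2 =
    (λ { .4 refl s>2 → period-21 s>2 }) , (λ _ → λ { (inj₁ ()) ; (inj₂ ()) }) ,
    (λ { refl refl →
         (λ { (inj₁ (x-even , _)) → proj₁ period-21-mod2 x-even ; (inj₂ (1-even , _)) → ⊥-elim (odd-one 1-even) }) ,
         (λ ¬ee → proj₂ period-21-mod2 (λ x-even → ¬ee (inj₁ (x-even , even-two)))) }) ,
    (λ _ ())
  edge-claim-C p13 x y s s≥2 =
    (λ { .6 refl s>2 → period-13 s>2 }) , (λ { refl _ → period-13-mod2 }) , (λ _ ()) , (λ _ ())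
  edge-claim-C p31 x y s s≥2 =
    (λ { .6 refl s>2 → period-31 s>2 }) , (λ { refl _ → period-31-mod2 }) , (λ _ ()) , (λ _ ())
  edge-claim-C p14 x y s s≥2 = (λ _ ()) , (λ _ → λ { (inj₁ ()) ; (inj₂ ()) }) , (λ _ ()) , (λ _ ())
  edge-claim-C p41 x y s s≥2 = (λ _ ()) , (λ _ → λ { (inj₁ ()) ; (inj₂ ()) }) , (λ _ ()) , (λ _ ())
  edge-claim-C p22 x y s s≥2 = (λ _ ()) , (λ _ → λ { (inj₁ ()) ; (inj₂ ()) }) , (λ _ ()) , (λ _ ())

  edge-claim-D : ∀ {a b} → AllowedPair a b → ∀ x y s → 2 ℕ.≤ s →
    ClaimD s (ArithPeriod s a b x y) a b (labelOf ℤ.∣ a * b ∣) (EENode x a) (OENode x a) (EENode b y) (OENode b y)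
  edge-claim-D p00 x y s s≥2 ()
  edge-claim-D p11 x y s s≥2 ()
  edge-claim-D p12 x y s s≥2 ()
  edge-claim-D p21 x y s s≥2 ()
  edge-claim-D p13 x y s s≥2 ()
  edge-claim-D p31 x y s s≥2 ()
  edge-claim-D p14 x y s s≥2 _ = (λ { (() , _) }) , doubled , λ _ → single
    where
    open Pair14 {s} {x} {y} s≥2
    doubled : Doubled s (+ 1) (+ 4) (OENode x (+ 1)) (OENode (+ 4) y) → ArithPeriod s (+ 1) (+ 4) x y (2 ℕ.* s)
    doubled (inj₁ (() , _) , _)
    doubled (inj₂ (_ , _ , inj₁ (_ , y-odd)) , 2∣s) = period-14-double 2∣s (λ 2∣y → y-odd (even-two∣ 2∣y))
    doubled (inj₂ (_ , _ , inj₂ (4-odd , _)) , _) = ⊥-elim (4-odd even-four)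
    single : ¬ Doubled s (+ 1) (+ 4) (OENode x (+ 1)) (OENode (+ 4) y) → ArithPeriod s (+ 1) (+ 4) x y s
    single ¬doubled with 2 ℕ∣.∣? ℤ.∣ y ∣ | 2 ℕ∣.∣? s
    ... | yes y-even | _       = period-14 (inj₂ (two∣-even {y} y-even))
    ... | no y-odd   | yes 2∣s = ⊥-elim (¬doubled (inj₂ (refl , refl , inj₁ (even-four , y-odd)) , 2∣s))
    ... | no _       | no ¬2∣s = period-14 (inj₁ ¬2∣s)
  edge-claim-D p41 x y s s≥2 _ = (λ { (() , _) }) , doubled , λ _ → single
    where
    open Pair41 {s} {x} {y} s≥2
    doubled : Doubled s (+ 4) (+ 1) (OENode x (+ 4)) (OENode (+ 1) y) → ArithPeriod s (+ 4) (+ 1) x y (2 ℕ.* s)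
    doubled (inj₂ (() , _) , _)
    doubled (inj₁ (_ , _ , inj₂ (x-odd , _)) , 2∣s) = period-41-double 2∣s (λ 2∣x → x-odd (even-two∣ 2∣x))
    doubled (inj₁ (_ , _ , inj₁ (_ , 4-odd)) , _) = ⊥-elim (4-odd even-four)
    single : ¬ Doubled s (+ 4) (+ 1) (OENode x (+ 4)) (OENode (+ 1) y) → ArithPeriod s (+ 4) (+ 1) x y s
    single ¬doubled with 2 ℕ∣.∣? ℤ.∣ x ∣ | 2 ℕ∣.∣? s
    ... | yes x-even | _       = period-41 (inj₂ (two∣-even {x} x-even))
    ... | no x-odd   | yes 2∣s = ⊥-elim (¬doubled (inj₁ (refl , refl , inj₂ (x-odd , even-four)) , 2∣s))
    ... | no _       | no ¬2∣s = period-41 (inj₁ ¬2∣s)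
  edge-claim-D p22 x y s s≥2 _ =
    (λ (_ , _ , (x-even , _) , (_ , y-even) , 2∣s) →
       period-22-arith (period-22-half 2∣s (two∣-even {x} x-even) (two∣-even {y} y-even) s≥2)) ,
    (λ { (inj₁ (() , _) , _) ; (inj₂ (() , _) , _) }) ,
    (λ ¬half _ → period-22-arith (period-22 s≥2 (λ (2∣s , 2∣x , 2∣y) →
       ¬half (refl , refl , (even-two∣ 2∣x , even-two) , (even-two , even-two∣ 2∣y) , 2∣s))))

  ≐⇒≈ : ∀ {n s} {A B : Mat n} → A ≐ B → A ≈[ s ] B
  ≐⇒≈ {s = s} {A} {B} A≐B l c =
    ℤ∣.∣⇒∣ᵤ (subst (s ∣ᶻ_) (sym (trans (cong (_- B l c) (A≐B l c)) (ℤₚ.+-inverseʳ (B l c)))) (∣ᶻ0 s))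

  -- Part (a).  r_i - I has the single nonzero row m_i, and r_i² = I because m_ii = -2.
  refl-minus-I : ∀ {n} (C : Cartan n) i l c → refl-mat C i l c - I l c ≡ I l i * m C i c
  refl-minus-I C i l c = trans (cong (_- I l c) (refl-entry C i l c)) (cancel (I l c) (I l i * m C i c))
    where
    cancel : ∀ a d → a + d - a ≡ d
    cancel = solve-∀

  refl-involution : ∀ {n} (C : Cartan n) i → (refl-mat C i ^ 2) ≐ I
  refl-involution C i l c = begin
    (r ⊗ (r ⊗ I)) l c
      ≡⟨ ⊗-cong (refl-as-first C i i) (λ l c → trans (∑-δʳ c (r l)) (refl-as-first C i i l c)) l c ⟩
    (Rank2 i i (m C i) 0⃗ ⊗ Rank2 i i (m C i) 0⃗) l c
      ≡⟨ Rank2-⊗ i i (m C i) 0⃗ (m C i) 0⃗ l c ⟩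
    I l c + I l i * (m C i c + m C i c + m C i i * m C i c + m C i i * + 0)
          + I l i * (+ 0 + + 0 + + 0 * m C i c + + 0 * + 0)
      ≡⟨ cong (λ d → I l c + I l i * (m C i c + m C i c + d * m C i c + d * + 0)
                          + I l i * (+ 0 + + 0 + + 0 * m C i c + + 0 * + 0)) (diag C i) ⟩
    I l c + I l i * (m C i c + m C i c + - + 2 * m C i c + - + 2 * + 0)
          + I l i * (+ 0 + + 0 + + 0 * m C i c + + 0 * + 0)
      ≡⟨ vanish (I l c) (I l i) (m C i c) ⟩
    I l c ∎
    where
    r = refl-mat C i
    vanish : ∀ a d x → a + d * (x + x + - + 2 * x + - + 2 * + 0) + d * (+ 0 + + 0 + + 0 * x + + 0 * + 0) ≡ a
    vanish = solve-∀

  EE⇒row-even : ∀ {n} (C : Cartan n) i → EE C i → ∀ c → 2 ∣ᶻ m C i c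
  EE⇒row-even C i (mL-even , mR-even) c with row-entry C i c
  ... | inj₁ e                  = subst (2 ∣ᶻ_) (sym e) (divides -[1+ 0 ] refl)
  ... | inj₂ (inj₁ e)           = subst (2 ∣ᶻ_) (sym e) (two∣-even {mL C i} mL-even)
  ... | inj₂ (inj₂ (inj₁ e))    = subst (2 ∣ᶻ_) (sym e) (two∣-even {mR C i} mR-even)
  ... | inj₂ (inj₂ (inj₂ e))    = subst (2 ∣ᶻ_) (sym e) (∣ᶻ0 2)

  reflection-trivial : ∀ {n} (C : Cartan n) i s → s ≡ 2 × EE C i → refl-mat C i ≈[ s ] I
  reflection-trivial C i .2 (refl , ee) l c =
    ℤ∣.∣⇒∣ᵤ (subst (2 ∣ᶻ_) (sym (refl-minus-I C i l c)) (ℤ∣.∣n⇒∣m*n (I l i) (EE⇒row-even C i ee c)))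

  -- ... and conversely r_i ≡ I (mod s) forces s ∣ m_ii = -2, so s = 2, and node i to be e-e.
  reflection-trivial⁻ : ∀ {n} (C : Cartan n) i s → 2 ℕ.≤ s → refl-mat C i ≈[ s ] I → s ≡ 2 × EE C i
  reflection-trivial⁻ C i s s≥2 r≈I = s≡2 , (mL-even , mR-even)
    where
    row : ∀ c → s ∣ᶻ m C i c
    row c = subst (s ∣ᶻ_) (trans (refl-minus-I C i i c) (trans (cong (_* m C i c) (I-diag i)) (ℤₚ.*-identityˡ _)))
                  (ℤ∣.∣ᵤ⇒∣ (r≈I i c))
    s≡2 : s ≡ 2
    s≡2 = ℕₚ.≤-antisym (ℕ∣.∣⇒≤ (ℤ∣.∣⇒∣ᵤ (subst (s ∣ᶻ_) (diag C i) (row i)))) s≥2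
    row-even : ∀ c → EvenZ (m C i c)
    row-even c = even-two∣ (subst (_∣ᶻ m C i c) s≡2 (row c))
    mL-even : EvenZ (mL C i)
    mL-even with mL-entry C i
    ... | inj₁ e             = subst EvenZ (sym e) even-zero
    ... | inj₂ (c , _ , e)   = subst EvenZ e (row-even c)
    mR-even : EvenZ (mR C i)
    mR-even with mR-entry C i
    ... | inj₁ e             = subst EvenZ (sym e) even-zero
    ... | inj₂ (c , _ , e)   = subst EvenZ e (row-even c)

  reflection-period : ∀ {n} (C : Cartan n) i s → 2 ℕ.≤ s → ¬ (s ≡ 2 × EE C i) → HasPeriod s (refl-mat C i) 2
  reflection-period C i s s≥2 nontrivial = s≤s z≤n , ≐⇒≈ (refl-involution C i) ,
    λ { 1 _ _ r¹≈I → nontrivial (reflection-trivial⁻ C i s s≥2 (≈I-resp (λ l c → ∑-δʳ c (refl-mat C i l)) r¹≈I))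
      ; (suc (suc k)) _ (s≤s (s≤s ())) }

  -- Part (b): for |i - j| ≥ 2 both products equal I + e_i m_iᵀ + e_j m_jᵀ.
  far-commute : ∀ {n} (C : Cartan n) s i j → toℕ i ℕ.+ 1 ℕ.< toℕ j →
    (refl-mat C i ⊗ refl-mat C j) ≈[ s ] (refl-mat C j ⊗ refl-mat C i)
  far-commute C s i j i+1<j = ≐⇒≈ (λ l c → trans (product-ij l c) (sym (product-ji l c)))
    where
    apart-ij : suc (suc (toℕ i)) ℕ.≤ toℕ j
    apart-ij = subst (λ z → suc z ℕ.≤ toℕ j) (ℕₚ.+-comm (toℕ i) 1) i+1<j
    mij≡0 : m C i j ≡ + 0
    mij≡0 = far-right-zero C i j apart-ij
    mji≡0 : m C j i ≡ + 0
    mji≡0 = far-left-zero C j i apart-ij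
    target = Rank2 i j (m C i) (m C j)
    product-ij : (refl-mat C i ⊗ refl-mat C j) ≐ target
    product-ij l c = begin
      (refl-mat C i ⊗ refl-mat C j) l c
        ≡⟨ ⊗-cong (refl-as-first C i j) (refl-as-second C i j) l c ⟩
      (Rank2 i j (m C i) 0⃗ ⊗ Rank2 i j 0⃗ (m C j)) l c
        ≡⟨ Rank2-⊗ i j (m C i) 0⃗ 0⃗ (m C j) l c ⟩
      _ ≡⟨ Rank2-cong i j (λ c → trans (cong (λ d → m C i c + + 0 + m C i i * + 0 + d * m C j c) mij≡0)
                                       (simplify (m C i c) (m C j c) (m C i i)))
                          (λ c → simplify′ (m C j c)) l c ⟩
      target l c ∎
      where
      simplify : ∀ u v d → u + + 0 + d * + 0 + + 0 * v ≡ u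
      simplify = solve-∀
      simplify′ : ∀ v → + 0 + v + + 0 * + 0 + + 0 * v ≡ v
      simplify′ = solve-∀
    product-ji : (refl-mat C j ⊗ refl-mat C i) ≐ target
    product-ji l c = begin
      (refl-mat C j ⊗ refl-mat C i) l c
        ≡⟨ ⊗-cong (refl-as-second C i j) (refl-as-first C i j) l c ⟩
      (Rank2 i j 0⃗ (m C j) ⊗ Rank2 i j (m C i) 0⃗) l c
        ≡⟨ Rank2-⊗ i j 0⃗ (m C j) (m C i) 0⃗ l c ⟩
      _ ≡⟨ Rank2-cong i j (λ c → simplify (m C i c))
                          (λ c → trans (cong (λ d → m C j c + + 0 + d * m C i c + m C j j * + 0) mji≡0)
                                       (simplify′ (m C i c) (m C j c) (m C j j))) l c ⟩
      target l c ∎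
      where
      simplify : ∀ u → + 0 + u + + 0 * u + + 0 * + 0 ≡ u
      simplify = solve-∀
      simplify′ : ∀ u v d → v + + 0 + + 0 * u + d * + 0 ≡ v
      simplify′ = solve-∀

  -- Parts (c) and (d) for an edge j → i of the string diagram: the arithmetic claims,
  -- with the period transferred to r_j r_i and a = m_ji, b = m_ij identified with the
  -- neighbouring Cartan integers m_{j,j+1}, m_{i,i-1} of the two nodes.
  module _ {n} (C : Cartan n) (s : ℕ) (s≥2 : 2 ℕ.≤ s) (j i : Fin n) (j→i : Pred j i) where
    private
      mR-j : mR C j ≡ m C j i
      mR-j = sym (mR-is C j i (sym j→i))
      mL-i : mL C i ≡ m C i j
      mL-i = mL-is C j i j→i

    edge-claim-c : ClaimC s (HasPeriod s (refl-mat C j ⊗ refl-mat C i)) (p C j i) (EE C j) (EE C i)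
    edge-claim-c = ClaimC-map (λ {q} → period-transfer C j i j→i s {q}) (λ {q} → period-transfer⁻ C j i j→i s {q})
      (subst₂ (λ a′ b′ → ClaimC s (ArithPeriod s (m C j i) (m C i j) (mL C j) (mR C i)) (p C j i)
                                  (EENode (mL C j) a′) (EENode b′ (mR C i)))
              (sym mR-j) (sym mL-i) (edge-claim-C (adjacent C j i j→i) (mL C j) (mR C i) s s≥2))

    edge-claim-d : ClaimD s (HasPeriod s (refl-mat C j ⊗ refl-mat C i)) (m C j i) (m C i j) (p C j i)
                          (EE C j) (OE C j) (EE C i) (OE C i)
    edge-claim-d = ClaimD-map (λ {q} → period-transfer C j i j→i s {q})
      (subst₂ (λ a′ b′ → ClaimD s (ArithPeriod s (m C j i) (m C i j) (mL C j) (mR C i)) (m C j i) (m C i j) (p C j i)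
                                  (EENode (mL C j) a′) (OENode (mL C j) a′) (EENode b′ (mR C i)) (OENode b′ (mR C i)))
              (sym mR-j) (sym mL-i) (edge-claim-D (adjacent C j i j→i) (mL C j) (mR C i) s s≥2))

open Development
open import Data.Nat using (ℕ; _≤_; _<_; _+_; _*_; _/_)
open import Data.Nat.Divisibility using (_∣_)
open import Data.Integer using (+_)
open import Data.Fin using (Fin; toℕ)
open import Data.Product using (_×_; _,_; proj₁; proj₂)
open import Data.Sum using (_⊎_)
open import Relation.Nullary using (¬_)
open import Relation.Binary.PropositionalEquality using (_≡_)

lemma3p1 : (n : ℕ) → 2 ≤ n → (C : Cartan n) → (s : ℕ) → 2 ≤ s →
    -- (a)
    (∀ i → (s ≡ 2 × EE C i → refl-mat C i ≈[ s ] I)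
         × (¬ (s ≡ 2 × EE C i) → HasPeriod s (refl-mat C i) 2))
    -- (b)
    × (∀ i j → toℕ i + 1 < toℕ j →
         (refl-mat C i ⊗ refl-mat C j) ≈[ s ] (refl-mat C j ⊗ refl-mat C i))
    -- (c)
    × (∀ j i → Pred j i →
         (∀ q → p C j i ≡ fin q → 2 < s →
            HasPeriod s (refl-mat C j ⊗ refl-mat C i) q)
         × (s ≡ 2 → (p C j i ≡ fin 3 ⊎ p C j i ≡ fin 6) →
            HasPeriod s (refl-mat C j ⊗ refl-mat C i) 3)
         × (s ≡ 2 → p C j i ≡ fin 4 →
            ((EE C j ⊎ EE C i) → HasPeriod s (refl-mat C j ⊗ refl-mat C i) 2)
            × (¬ (EE C j ⊎ EE C i) → HasPeriod s (refl-mat C j ⊗ refl-mat C i) 4))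
         × (s ≡ 2 → p C j i ≡ fin 2 →
            (HasPeriod s (refl-mat C j ⊗ refl-mat C i) 1 → EE C j × EE C i)
            × (EE C j × EE C i →
                 HasPeriod s (refl-mat C j ⊗ refl-mat C i) 1
                 × refl-mat C j ≈[ s ] I × refl-mat C i ≈[ s ] I)))
    -- (d)
    × (∀ j i → Pred j i → p C j i ≡ ∞ →
         ((m C j i ≡ + 2 × m C i j ≡ + 2 × EE C j × EE C i × 2 ∣ s) →
            HasPeriod s (refl-mat C j ⊗ refl-mat C i) (s / 2))
         × ((((m C j i ≡ + 4 × m C i j ≡ + 1 × OE C j)
              ⊎ (m C i j ≡ + 4 × m C j i ≡ + 1 × OE C i)) × 2 ∣ s) →
            HasPeriod s (refl-mat C j ⊗ refl-mat C i) (2 * s))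
         × (¬ (m C j i ≡ + 2 × m C i j ≡ + 2 × EE C j × EE C i × 2 ∣ s) →
            ¬ (((m C j i ≡ + 4 × m C i j ≡ + 1 × OE C j)
                 ⊎ (m C i j ≡ + 4 × m C j i ≡ + 1 × OE C i)) × 2 ∣ s) →
            HasPeriod s (refl-mat C j ⊗ refl-mat C i) s))
lemma3p1 n _ C s s≥2 =
  (λ i → reflection-trivial C i s , reflection-period C i s s≥2) ,
  far-commute C s ,
  (λ j i j→i →
     let (c₁ , c₂ , c₃ , c₄) = edge-claim-c C s s≥2 j i j→i
     -- for label 2 and s = 2, the e-e condition also makes both generators trivial (part (a))
     in c₁ , c₂ , c₃ , λ s≡2 p≡2 →
          proj₁ (c₄ s≡2 p≡2) ,
          λ (ee-j , ee-i) → proj₂ (c₄ s≡2 p≡2) (ee-j , ee-i) ,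
                            reflection-trivial C j s (s≡2 , ee-j) , reflection-trivial C i s (s≡2 , ee-i)) ,
  edge-claim-d C s s≥2
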